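{- The set of all odd-dimensional Dehn-Sommerville manifolds (including the empty complex as the Dehn-Sommerville $(-1)$-manifold) is a submonoid of the monoid of finite abstract simplicial complexes under the join operation: if $A$ is a Dehn-Sommerville $a$-manifold and $B$ a Dehn-Sommerville $b$-manifold on disjoint vertex sets, with $a,b$ odd, then $A\oplus B$ is a Dehn-Sommerville $(a+b+1)$-manifold.
   Context: A finite abstract simplicial complex $G$ is a finite set of non-empty finite sets closed under taking non-empty subsets. For $x\in G$, $\omega(x)=(-1)^{|x|-1}$ and $\chi(A)=\sum_{x\in A}\omega(x)$. The star of $x$ is $U(x)=\{y\in G: x\subset y\}$, $\overline{U(x)}=\{z\in G: z\subset y\text{ for some }y\in U(x)\}$, and the unit sphere is $S(x)=\overline{U(x)}\setminus U(x)$. The empty complex is the Dehn-Sommerville $(-1)$-sphere (and $(-1)$-manifold); for $q\ge 0$ a non-empty complex is a Dehn-Sommerville $q$-manifold if every unit sphere is a Dehn-Sommerville $(q-1)$-sphere, and a Dehn-Sommerville $q$-sphere is a Dehn-Sommerville $q$-manifold with $\chi=1+(-1)^q$. The join of complexes $A,B$ with disjoint vertex sets is $A\oplus B=A\cup B\cup\{a\cup b: a\in A, b\in B\}$. -}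

module Defs where

open import Data.Nat using (ℕ; _<_; _≤?_)
open import Data.Nat.Properties using (_≟_)
open import Data.Integer as ℤ using (ℤ; +_; -_; _^_)
open import Data.List using (List; []; _∷_; _++_; length; map; concatMap; filter; merge; foldr)
open import Data.List.Relation.Unary.All using (All; all?)
open import Data.List.Relation.Unary.Any using (any?)
open import Data.List.Relation.Unary.Unique.Propositional using (Unique)
open import Data.List.Relation.Unary.Linked using (Linked)
open import Data.List.Membership.Propositional using (_∈_)
open import Data.List.Membership.DecPropositional _≟_ using (_∈?_)
open import Data.Product using (Σ; _×_; _,_)
open import Data.Empty using (⊥)
open import Relation.Nullary using (¬_; Dec; ¬?; _×-dec_)
open import Relation.Binary.PropositionalEquality using (_≡_; _≢_)

-- Vertices are natural numbers.  A face (a non-empty finite set of vertices)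
-- is represented canonically by the strictly increasing list of its elements.
Face : Set
Face = List ℕ

Complex : Set
Complex = List Face

_⊑_ : Face → Face → Set
x ⊑ y = All (_∈ y) x

_⊑?_ : (x y : Face) → Dec (x ⊑ y)
x ⊑? y = all? (_∈? y) x

IsFace : Face → Set
IsFace x = (x ≢ []) × Linked _<_ x

IsComplex : Complex → Set
IsComplex G =
  Unique G × All IsFace G ×
  (∀ {x y} → x ∈ G → IsFace y → y ⊑ x → y ∈ G)

-- ω(x) = (-1)^(|x|-1) = - (-1)^|x|
ω : Face → ℤ
ω x = - ((- (+ 1)) ^ length x)

χ : Complex → ℤ
χ A = foldr (λ x s → ω x ℤ.+ s) (+ 0) A

U : Complex → Face → Complex
U G x = filter (x ⊑?_) G

Ubar : Complex → Face → Complex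
Ubar G x = filter (λ z → any? (z ⊑?_) (U G x)) G

-- unit sphere S(x) = closure(U(x)) \ U(x)
S : Complex → Face → Complex
S G x = filter (λ z → any? (z ⊑?_) (U G x) ×-dec ¬? (x ⊑? z)) G

-- Dehn–Sommerville manifolds and spheres, indexed by n = q + 1 ∈ ℕ
-- (so index 0 is dimension q = -1).
mutual
  DSManifold₊₁ : ℕ → Complex → Set
  DSManifold₊₁ ℕ.zero G = G ≡ []
  DSManifold₊₁ (ℕ.suc n) G = (G ≢ []) × (∀ {x} → x ∈ G → DSSphere₊₁ n (S G x))

  DSSphere₊₁ : ℕ → Complex → Set
  DSSphere₊₁ ℕ.zero G = G ≡ []
  -- q = m ≥ 0 : DS q-manifold with χ = 1 + (-1)^q
  DSSphere₊₁ (ℕ.suc m) G = DSManifold₊₁ (ℕ.suc m) G × (χ G ≡ + 1 ℤ.+ (- (+ 1)) ^ m)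

IsDSManifold : ℤ → Complex → Set
IsDSManifold q G = Σ ℕ λ n → (q ≡ + n ℤ.- + 1) × DSManifold₊₁ n G

Odd : ℤ → Set
Odd a = Σ ℤ λ k → a ≡ + 2 ℤ.* k ℤ.+ + 1

DisjointVertices : Complex → Complex → Set
DisjointVertices A B =
  ∀ {x y v} → x ∈ A → y ∈ B → v ∈ x → v ∈ y → ⊥

-- join A ⊕ B = A ∪ B ∪ { a ∪ b : a ∈ A, b ∈ B }
-- (the union of disjoint strictly increasing lists is computed by merging)
_⊕_ : Complex → Complex → Complex
A ⊕ B = A ++ B ++ concatMap (λ a → map (merge _≤?_ a) B) A

-- A complex is recognised as a Dehn–Sommerville manifold by its links: the link of z inside
-- the unit sphere S(x) is the join of the boundary of the simplex x ∖ z with the link of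
-- x ∪ z in K, so by induction on the dimension K is a DS (n - 1)-manifold iff the link of
-- every face with k vertices is empty exactly when k = n and has reduced Euler characteristic
-- χ - 1 = (-1)^(n - k + 1), as for an (n - k - 1)-sphere.  Links in a join are joins of links
-- and χ̃(A ⊕ B) = -χ̃(A) χ̃(B), so this link condition passes to A ⊕ B as soon as it also holds
-- for the empty face of each factor, i.e. as soon as A and B have the Euler characteristic of
-- spheres.  For odd-dimensional manifolds this is χ = 0, the Dehn–Sommerville relation
-- obtained by summing ω(x) ω(y) over pairs of faces x ⊆ y in two ways.

module Submission where

open import Defs
open import Data.Nat as ℕ using (ℕ; zero; suc; _<_; _≤?_; z≤n; s≤s)
import Data.Nat.Properties as ℕ
open import Algebra.Properties.CommutativeSemigroup ℕ.+-commutativeSemigroup using () renaming (interchange to +-interchange)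
open import Data.Integer as ℤ using (ℤ; +_; -_; -[1+_]; -1ℤ; _+_; _-_; _*_; _^_; ∣_∣)
import Data.Integer.Properties as ℤ
open import Data.Integer.Tactic.RingSolver using (solve-∀)
open import Data.List using (List; []; _∷_; _++_; length; map; concatMap; filter; merge; foldr)
import Data.List.Properties as List
open import Data.List.Relation.Unary.All as All using (All; []; _∷_)
open import Data.List.Relation.Unary.AllPairs as AllPairs using (AllPairs; []; _∷_)
import Data.List.Relation.Unary.AllPairs.Properties as AllPairs
open import Data.List.Relation.Unary.All.Properties using () renaming (map⁺ to All-map⁺)
open import Data.List.Relation.Unary.Any using (here; there; any?)
open import Data.List.Relation.Unary.Linked using (Linked)
open import Data.List.Relation.Unary.Linked.Properties using (Linked⇒AllPairs; AllPairs⇒Linked)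
open import Data.List.Relation.Unary.Unique.Propositional using (Unique)
import Data.List.Relation.Unary.Unique.Propositional.Properties as Unique
open import Data.List.Relation.Unary.Sorted.TotalOrder using (Sorted)
open import Data.List.Relation.Unary.Sorted.TotalOrder.Properties using (↗↭↗⇒≋; AllPairs⇒Sorted; Sorted⇒AllPairs; merge⁺)
open import Data.List.Relation.Binary.Permutation.Propositional using (_↭_; refl; prep; swap; trans; ↭⇒↭ₛ; ↭-sym)
open import Data.List.Relation.Binary.Permutation.Propositional.Properties using (merge-↭; ∈-resp-↭; ↭-length)
import Data.List.Relation.Binary.Permutation.Setoid.Properties as Permutation
open import Data.List.Relation.Binary.Equality.Propositional using (≋⇒≡)
open import Data.List.Relation.Binary.Disjoint.Propositional using (Disjoint)
open import Data.List.Relation.Binary.Disjoint.Propositional.Properties using () renaming (sym to disjoint-sym)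
open import Data.List.Relation.Binary.BagAndSetEquality using (∼bag⇒↭; _∼[_]_; set)
open import Data.List.Membership.Propositional using (_∈_; _∉_; find; lose)
open import Data.List.Membership.Propositional.Properties
  using (∈-++⁺ˡ; ∈-++⁺ʳ; ∈-++⁻; ∈-map⁺; ∈-map⁻; ∈-filter⁺; ∈-filter⁻; ∈-concatMap⁺; ∈-concatMap⁻)
open import Data.List.Membership.Propositional.Properties.WithK using (unique∧set⇒bag)
open import Data.List.Membership.DecPropositional ℕ._≟_ using (_∈?_)
open import Data.List.Membership.DecPropositional (List.≡-dec ℕ._≟_) using () renaming (_∈?_ to _∈ᶠ?_)
open import Data.Bool using (true; false; if_then_else_)
open import Data.Product using (∃; _×_; _,_; proj₁; proj₂)
open import Data.Sum using (_⊎_; inj₁; inj₂; [_,_])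
open import Data.Empty using (⊥; ⊥-elim)
open import Function using (id; _∘_; case_of_)
open import Function.Bundles using (Equivalence; mk⇔)
open import Function.Properties.Equivalence using () renaming (sym to ⇔-sym)
open import Relation.Nullary using (¬_; Dec; does; yes; no; ¬?; _×-dec_)
open import Relation.Unary using (Decidable)
open import Relation.Binary.PropositionalEquality
  using (_≡_; _≢_; refl; sym; cong; cong₂; subst; setoid; module ≡-Reasoning)
  renaming (trans to ≡-trans)

private variable
  m n v : ℕ
  a b c d x y z u : Face
  K L : Complex

suc-pred-length : x ≢ [] → suc (ℕ.pred (length x)) ≡ length x
suc-pred-length {[]} []≢[] = ⊥-elim ([]≢[] refl)
suc-pred-length {_ ∷ _} _ = refl

∉[] : ∀ {A : Set} {a : A} → a ∉ []
∉[] ()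

∉⇒≡[] : ∀ {A : Set} {xs : List A} → (∀ {a} → a ∉ xs) → xs ≡ []
∉⇒≡[] {xs = []} _ = refl
∉⇒≡[] {xs = a ∷ xs} a∉ = ⊥-elim (a∉ (here refl))

_≟_ : (x y : Face) → Dec (x ≡ y)
_≟_ = List.≡-dec ℕ._≟_

Increasing : Face → Set
Increasing = AllPairs _<_

linked⇒increasing : Linked _<_ x → Increasing x
linked⇒increasing = Linked⇒AllPairs ℕ.<-trans

increasing⇒unique : Increasing x → Unique x
increasing⇒unique = AllPairs.map λ m<n m≡n → ℕ.<-irrefl m≡n m<n

increasing⇒sorted : Increasing x → Sorted ℕ.≤-totalOrder x
increasing⇒sorted = AllPairs⇒Sorted ℕ.≤-totalOrder ∘ AllPairs.map ℕ.<⇒≤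

⊑-antisym : Increasing x → Increasing y → x ⊑ y → y ⊑ x → x ≡ y
⊑-antisym ix iy x⊑y y⊑x =
  ≋⇒≡ (↗↭↗⇒≋ ℕ.≤-totalOrder (increasing⇒sorted ix) (increasing⇒sorted iy) (↭⇒↭ₛ (∼bag⇒↭
    (unique∧set⇒bag (increasing⇒unique ix) (increasing⇒unique iy)
      (mk⇔ (All.lookup x⊑y) (All.lookup y⊑x))))))

⊑-refl : x ⊑ x
⊑-refl = All.tabulate λ v∈x → v∈x

⊑-trans : x ⊑ y → y ⊑ z → x ⊑ z
⊑-trans x⊑y y⊑z = All.map (All.lookup y⊑z) x⊑y

⊑-[] : x ⊑ [] → x ≡ []
⊑-[] [] = refl

∈-∷-≢ : ∀ {u} → u ≢ v → u ∈ v ∷ x → u ∈ x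
∈-∷-≢ u≢v (here u≡v) = ⊥-elim (u≢v u≡v)
∈-∷-≢ _ (there u∈x) = u∈x

⊑-∷ : x ⊑ (v ∷ x)
⊑-∷ = All.tabulate there

≢[]⇒∈ : x ≢ [] → ∃ λ v → v ∈ x
≢[]⇒∈ {[]} x≢[] = ⊥-elim (x≢[] refl)
≢[]⇒∈ {v ∷ x} _ = v , here refl

-- Merge of sorted lists: the union of faces only when they are disjoint, otherwise shared vertices repeat.
infixl 25 _∪_
_∪_ : Face → Face → Face
_∪_ = merge _≤?_

∈-∪⁻ : ∀ x y → v ∈ x ∪ y → v ∈ x ⊎ v ∈ y
∈-∪⁻ x y v∈x∪y = ∈-++⁻ x (∈-resp-↭ (merge-↭ _≤?_ x y) v∈x∪y)

∈-∪⁺ˡ : ∀ y → v ∈ x → v ∈ x ∪ y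
∈-∪⁺ˡ {x = x} y v∈x = ∈-resp-↭ (↭-sym (merge-↭ _≤?_ x y)) (∈-++⁺ˡ v∈x)

∈-∪⁺ʳ : ∀ x → v ∈ y → v ∈ x ∪ y
∈-∪⁺ʳ {y = y} x v∈y = ∈-resp-↭ (↭-sym (merge-↭ _≤?_ x y)) (∈-++⁺ʳ x v∈y)

length-∪ : ∀ x y → length (x ∪ y) ≡ length x ℕ.+ length y
length-∪ x y = ≡-trans (↭-length (merge-↭ _≤?_ x y)) (List.length-++ x)

∪-identityʳ : ∀ x → x ∪ [] ≡ x
∪-identityʳ [] = refl
∪-identityʳ (v ∷ x) = refl

∪-nonemptyˡ : ∀ y → x ≢ [] → x ∪ y ≢ []
∪-nonemptyˡ y x≢[] e with ≢[]⇒∈ x≢[]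
... | v , v∈x with subst (v ∈_) e (∈-∪⁺ˡ y v∈x)
... | ()

∪-nonemptyʳ : ∀ x → y ≢ [] → x ∪ y ≢ []
∪-nonemptyʳ x y≢[] e with ≢[]⇒∈ y≢[]
... | v , v∈y with subst (v ∈_) e (∈-∪⁺ʳ x v∈y)
... | ()

-- merge keeps the order, and disjointness of the increasing inputs makes it strict.
increasing-∪ : Increasing x → Increasing y → Disjoint x y → Increasing (x ∪ y)
increasing-∪ {x} {y} ix iy x#y =
  AllPairs.zipWith (λ (m≤n , m≢n) → ℕ.≤∧≢⇒< m≤n m≢n)
    ( Sorted⇒AllPairs ℕ.≤-totalOrder (merge⁺ ℕ.≤-decTotalOrder (increasing⇒sorted ix) (increasing⇒sorted iy))
    , Permutation.Unique-resp-↭ (setoid ℕ) (↭⇒↭ₛ (↭-sym (merge-↭ _≤?_ x y)))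
        (Unique.++⁺ (increasing⇒unique ix) (increasing⇒unique iy) x#y))

∪-⊑ : x ⊑ z → y ⊑ z → x ∪ y ⊑ z
∪-⊑ {x} {z} {y} x⊑z y⊑z = All.tabulate λ v∈x∪y → [ All.lookup x⊑z , All.lookup y⊑z ] (∈-∪⁻ x y v∈x∪y)

⊑-∪ˡ : ∀ x y → x ⊑ x ∪ y
⊑-∪ˡ x y = All.tabulate (∈-∪⁺ˡ y)

⊑-∪ʳ : ∀ x y → y ⊑ x ∪ y
⊑-∪ʳ x y = All.tabulate (∈-∪⁺ʳ x)

disjoint-∪ˡ : Disjoint x z → Disjoint y z → Disjoint (x ∪ y) z
disjoint-∪ˡ {x} {y = y} x#z y#z (v∈x∪y , v∈z) = [ x#z ∘ (_, v∈z) , y#z ∘ (_, v∈z) ] (∈-∪⁻ x y v∈x∪y)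

disjoint-∪ʳ : Disjoint z x → Disjoint z y → Disjoint z (x ∪ y)
disjoint-∪ʳ z#x z#y = disjoint-sym (disjoint-∪ˡ (disjoint-sym z#x) (disjoint-sym z#y))

∪-cancelˡ : Increasing a → Increasing c → Disjoint a d → Disjoint c b → a ∪ b ≡ c ∪ d → a ≡ c
∪-cancelˡ {a} {c} {d} {b} ia ic a#d c#b e = ⊑-antisym ia ic (All.tabulate a⊆c) (All.tabulate c⊆a)
  where
  a⊆c : ∀ {v} → v ∈ a → v ∈ c
  a⊆c v∈a with ∈-∪⁻ c d (subst (_ ∈_) e (∈-∪⁺ˡ b v∈a))
  ... | inj₁ v∈c = v∈c
  ... | inj₂ v∈d = ⊥-elim (a#d (v∈a , v∈d))
  c⊆a : ∀ {v} → v ∈ c → v ∈ a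
  c⊆a v∈c with ∈-∪⁻ a b (subst (_ ∈_) (sym e) (∈-∪⁺ˡ d v∈c))
  ... | inj₁ v∈a = v∈a
  ... | inj₂ v∈b = ⊥-elim (c#b (v∈c , v∈b))

∪-cancelʳ : Increasing b → Increasing d → Disjoint a d → Disjoint c b → a ∪ b ≡ c ∪ d → b ≡ d
∪-cancelʳ {b} {d} {a} {c} ib id a#d c#b e = ⊑-antisym ib id (All.tabulate b⊆d) (All.tabulate d⊆b)
  where
  b⊆d : ∀ {v} → v ∈ b → v ∈ d
  b⊆d v∈b with ∈-∪⁻ c d (subst (_ ∈_) e (∈-∪⁺ʳ a v∈b))
  ... | inj₁ v∈c = ⊥-elim (c#b (v∈c , v∈b))
  ... | inj₂ v∈d = v∈d
  d⊆b : ∀ {v} → v ∈ d → v ∈ b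
  d⊆b v∈d with ∈-∪⁻ a b (subst (_ ∈_) (sym e) (∈-∪⁺ʳ c v∈d))
  ... | inj₁ v∈a = ⊥-elim (a#d (v∈a , v∈d))
  ... | inj₂ v∈b = v∈b

∪-interchange : ∀ a b c d → Increasing (a ∪ b ∪ (c ∪ d)) → Increasing (a ∪ c ∪ (b ∪ d)) →
                a ∪ b ∪ (c ∪ d) ≡ a ∪ c ∪ (b ∪ d)
∪-interchange a b c d i₁ i₂ = ⊑-antisym i₁ i₂
  (∪-⊑ (∪-⊑ (⊑-trans (⊑-∪ˡ a c) (⊑-∪ˡ (a ∪ c) (b ∪ d))) (⊑-trans (⊑-∪ˡ b d) (⊑-∪ʳ (a ∪ c) (b ∪ d))))
       (∪-⊑ (⊑-trans (⊑-∪ʳ a c) (⊑-∪ˡ (a ∪ c) (b ∪ d))) (⊑-trans (⊑-∪ʳ b d) (⊑-∪ʳ (a ∪ c) (b ∪ d)))))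
  (∪-⊑ (∪-⊑ (⊑-trans (⊑-∪ˡ a b) (⊑-∪ˡ (a ∪ b) (c ∪ d))) (⊑-trans (⊑-∪ˡ c d) (⊑-∪ʳ (a ∪ b) (c ∪ d))))
       (∪-⊑ (⊑-trans (⊑-∪ʳ a b) (⊑-∪ˡ (a ∪ b) (c ∪ d))) (⊑-trans (⊑-∪ʳ c d) (⊑-∪ʳ (a ∪ b) (c ∪ d)))))

infixl 30 _∩_ _∖_
_∩_ : Face → Face → Face
x ∩ y = filter (_∈? y) x

_∖_ : Face → Face → Face
x ∖ y = filter (λ v → ¬? (v ∈? y)) x

∈-∩⁻ : ∀ x y → v ∈ x ∩ y → v ∈ x × v ∈ y
∈-∩⁻ x y = ∈-filter⁻ (_∈? y)

∈-∩⁺ : ∀ y → v ∈ x → v ∈ y → v ∈ x ∩ y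
∈-∩⁺ y = ∈-filter⁺ (_∈? y)

∈-∖⁻ : ∀ x y → v ∈ x ∖ y → v ∈ x × v ∉ y
∈-∖⁻ x y = ∈-filter⁻ (λ v → ¬? (v ∈? y))

∈-∖⁺ : ∀ y → v ∈ x → v ∉ y → v ∈ x ∖ y
∈-∖⁺ y = ∈-filter⁺ (λ v → ¬? (v ∈? y))

increasing-∩ : ∀ y → Increasing x → Increasing (x ∩ y)
increasing-∩ y = AllPairs.filter⁺ (_∈? y)

increasing-∖ : ∀ y → Increasing x → Increasing (x ∖ y)
increasing-∖ y = AllPairs.filter⁺ (λ v → ¬? (v ∈? y))

∩-⊑ˡ : ∀ x y → x ∩ y ⊑ x
∩-⊑ˡ x y = All.tabulate (proj₁ ∘ ∈-∩⁻ x y)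

∩-⊑ʳ : ∀ x y → x ∩ y ⊑ y
∩-⊑ʳ x y = All.tabulate (proj₂ ∘ ∈-∩⁻ x y)

∖-⊑ : ∀ x y → x ∖ y ⊑ x
∖-⊑ x y = All.tabulate (proj₁ ∘ ∈-∖⁻ x y)

∖-disjoint : ∀ x y → Disjoint (x ∖ y) y
∖-disjoint x y (v∈x∖y , v∈y) = proj₂ (∈-∖⁻ x y v∈x∖y) v∈y

∈-∩∖ : ∀ x y → v ∈ x → v ∈ x ∩ y ⊎ v ∈ x ∖ y
∈-∩∖ {v} x y v∈x with v ∈? y
... | yes v∈y = inj₁ (∈-∩⁺ y v∈x v∈y)
... | no v∉y = inj₂ (∈-∖⁺ y v∈x v∉y)

∩∪∖ : ∀ y → Increasing x → x ≡ x ∩ y ∪ x ∖ y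
∩∪∖ {x} y ix = ⊑-antisym ix (increasing-∪ (increasing-∩ y ix) (increasing-∖ y ix) ∩#∖)
  (All.tabulate λ v∈x → [ ∈-∪⁺ˡ (x ∖ y) , ∈-∪⁺ʳ (x ∩ y) ] (∈-∩∖ x y v∈x))
  (∪-⊑ (∩-⊑ˡ x y) (∖-⊑ x y))
  where
  ∩#∖ : Disjoint (x ∩ y) (x ∖ y)
  ∩#∖ (v∈x∩y , v∈x∖y) = ∖-disjoint x y (v∈x∖y , proj₂ (∈-∩⁻ x y v∈x∩y))

∪-∖ : Increasing x → Increasing y → x ⊑ y → y ≡ x ∪ y ∖ x
∪-∖ {x} {y} ix iy x⊑y = ⊑-antisym iy (increasing-∪ ix (increasing-∖ x iy) (disjoint-sym (∖-disjoint y x)))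
  (All.tabulate λ v∈y → [ ∈-∪⁺ˡ (y ∖ x) ∘ All.lookup (∩-⊑ʳ y x) , ∈-∪⁺ʳ x ] (∈-∩∖ y x v∈y))
  (∪-⊑ x⊑y (∖-⊑ y x))

neg*neg : ∀ i j → - i * - j ≡ i * j
neg*neg = solve-∀

infix 8 -1^_
-1^_ : ℕ → ℤ
-1^ n = -1ℤ ^ n

-1^-suc : ∀ n → -1^ suc n ≡ - -1^ n
-1^-suc n = ℤ.-1*i≡-i (-1^ n)

-1^-+ : ∀ m n → -1^ (m ℕ.+ n) ≡ -1^ m * -1^ n
-1^-+ = ℤ.^-distribˡ-+-* -1ℤ

-1^-2+ : ∀ n → -1^ suc (suc n) ≡ -1^ n
-1^-2+ n = ≡-trans (-1^-suc (suc n)) (≡-trans (cong -_ (-1^-suc n)) (ℤ.neg-involutive (-1^ n)))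

-1^-square : ∀ n → -1^ n * -1^ n ≡ + 1
-1^-square zero = refl
-1^-square (suc n) = begin
  -1^ suc n * -1^ suc n   ≡⟨ cong₂ _*_ (-1^-suc n) (-1^-suc n) ⟩
  - -1^ n * - -1^ n       ≡⟨ neg*neg (-1^ n) (-1^ n) ⟩
  -1^ n * -1^ n           ≡⟨ -1^-square n ⟩
  + 1                     ∎
  where open ≡-Reasoning

ω-square : ∀ x → ω x * ω x ≡ + 1
ω-square x = ≡-trans (neg*neg (-1^ length x) (-1^ length x)) (-1^-square (length x))

∑ : ∀ {A : Set} → (A → ℤ) → List A → ℤ
∑ f = foldr (λ a s → f a + s) (+ 0)

module _ {A : Set} where

  ∑-cong : ∀ {f g : A → ℤ} xs → (∀ {x} → x ∈ xs → f x ≡ g x) → ∑ f xs ≡ ∑ g xs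
  ∑-cong [] f≗g = refl
  ∑-cong (x ∷ xs) f≗g = cong₂ _+_ (f≗g (here refl)) (∑-cong xs (f≗g ∘ there))

  ∑-++ : ∀ (f : A → ℤ) xs ys → ∑ f (xs ++ ys) ≡ ∑ f xs + ∑ f ys
  ∑-++ f [] ys = sym (ℤ.+-identityˡ (∑ f ys))
  ∑-++ f (x ∷ xs) ys = ≡-trans (cong (_+_ (f x)) (∑-++ f xs ys)) (sym (ℤ.+-assoc (f x) (∑ f xs) (∑ f ys)))

  ∑-↭ : ∀ (f : A → ℤ) {xs ys} → xs ↭ ys → ∑ f xs ≡ ∑ f ys
  ∑-↭ f refl = refl
  ∑-↭ f (prep x p) = cong (_+_ (f x)) (∑-↭ f p)
  ∑-↭ f (swap {xs} {ys} x y p) = begin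
    f x + (f y + ∑ f xs)   ≡⟨ sym (ℤ.+-assoc (f x) (f y) (∑ f xs)) ⟩
    f x + f y + ∑ f xs     ≡⟨ cong₂ _+_ (ℤ.+-comm (f x) (f y)) (∑-↭ f p) ⟩
    f y + f x + ∑ f ys     ≡⟨ ℤ.+-assoc (f y) (f x) (∑ f ys) ⟩
    f y + (f x + ∑ f ys)   ∎
    where open ≡-Reasoning
  ∑-↭ f (trans p q) = ≡-trans (∑-↭ f p) (∑-↭ f q)

  ∑-0 : ∀ xs → ∑ {A} (λ _ → + 0) xs ≡ + 0
  ∑-0 [] = refl
  ∑-0 (x ∷ xs) = ≡-trans (ℤ.+-identityˡ _) (∑-0 xs)

  ∑-+ : ∀ (f g : A → ℤ) xs → ∑ (λ x → f x + g x) xs ≡ ∑ f xs + ∑ g xs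
  ∑-+ f g [] = refl
  ∑-+ f g (x ∷ xs) = ≡-trans (cong (_+_ (f x + g x)) (∑-+ f g xs)) (medial (f x) (g x) (∑ f xs) (∑ g xs))
    where
    medial : ∀ a b c d → a + b + (c + d) ≡ a + c + (b + d)
    medial = solve-∀

  ∑-*ˡ : ∀ i (f : A → ℤ) xs → i * ∑ f xs ≡ ∑ (λ x → i * f x) xs
  ∑-*ˡ i f [] = ℤ.*-zeroʳ i
  ∑-*ˡ i f (x ∷ xs) = ≡-trans (ℤ.*-distribˡ-+ i (f x) (∑ f xs)) (cong (_+_ (i * f x)) (∑-*ˡ i f xs))

  ∑-neg : ∀ (f : A → ℤ) xs → ∑ (λ x → - f x) xs ≡ - ∑ f xs
  ∑-neg f [] = refl
  ∑-neg f (x ∷ xs) = ≡-trans (cong (_+_ (- f x)) (∑-neg f xs)) (sym (ℤ.neg-distrib-+ (f x) (∑ f xs)))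

  ∑-filter : ∀ {P : A → Set} (P? : Decidable P) (f : A → ℤ) xs →
             ∑ f (filter P? xs) ≡ ∑ (λ x → if does (P? x) then f x else + 0) xs
  ∑-filter P? f [] = refl
  ∑-filter P? f (x ∷ xs) with P? x
  ... | yes _ = cong (_+_ (f x)) (∑-filter P? f xs)
  ... | no _ = ≡-trans (∑-filter P? f xs) (sym (ℤ.+-identityˡ _))

  ∑-comm : ∀ (F : A → A → ℤ) xs ys → ∑ (λ x → ∑ (F x) ys) xs ≡ ∑ (λ y → ∑ (λ x → F x y) xs) ys
  ∑-comm F [] ys = sym (∑-0 ys)
  ∑-comm F (x ∷ xs) ys =
    ≡-trans (cong (_+_ (∑ (F x) ys)) (∑-comm F xs ys)) (sym (∑-+ (F x) (λ y → ∑ (λ x → F x y) xs) ys))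

χ-++ : ∀ K L → χ (K ++ L) ≡ χ K + χ L
χ-++ = ∑-++ ω

χ-resp-set : Unique K → Unique L → K ∼[ set ] L → χ K ≡ χ L
χ-resp-set uK uL K∼L = ∑-↭ ω (∼bag⇒↭ (unique∧set⇒bag uK uL K∼L))

χ̃ : Complex → ℤ
χ̃ K = χ K - + 1

ω-∪ : ∀ x y → ω (x ∪ y) ≡ - (ω x * ω y)
ω-∪ x y = begin
  - -1^ length (x ∪ y)                    ≡⟨ cong (-_ ∘ -1^_) (length-∪ x y) ⟩
  - -1^ (length x ℕ.+ length y)           ≡⟨ cong -_ (-1^-+ (length x) (length y)) ⟩
  - (-1^ length x * -1^ length y)         ≡⟨ cong -_ (sym (neg*neg (-1^ length x) (-1^ length y))) ⟩
  - (- -1^ length x * - -1^ length y)     ∎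
  where open ≡-Reasoning

χ-map-∪ : ∀ x L → χ (map (x ∪_) L) ≡ - (ω x * χ L)
χ-map-∪ x [] = sym (cong -_ (ℤ.*-zeroʳ (ω x)))
χ-map-∪ x (y ∷ L) = begin
  ω (x ∪ y) + χ (map (x ∪_) L)         ≡⟨ cong₂ _+_ (ω-∪ x y) (χ-map-∪ x L) ⟩
  - (ω x * ω y) + - (ω x * χ L)        ≡⟨ distrib (ω x) (ω y) (χ L) ⟩
  - (ω x * (ω y + χ L))                ∎
  where
  open ≡-Reasoning
  distrib : ∀ i j k → - (i * j) + - (i * k) ≡ - (i * (j + k))
  distrib = solve-∀

χ-joinFaces : ∀ A B → χ (concatMap (λ a → map (a ∪_) B) A) ≡ - (χ A * χ B)
χ-joinFaces [] B = refl
χ-joinFaces (a ∷ A) B = begin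
  χ (map (a ∪_) B ++ concatMap (λ a → map (a ∪_) B) A)          ≡⟨ χ-++ (map (a ∪_) B) _ ⟩
  χ (map (a ∪_) B) + χ (concatMap (λ a → map (a ∪_) B) A)       ≡⟨ cong₂ _+_ (χ-map-∪ a B) (χ-joinFaces A B) ⟩
  - (ω a * χ B) + - (χ A * χ B)                                  ≡⟨ distrib (ω a) (χ A) (χ B) ⟩
  - ((ω a + χ A) * χ B)                                          ∎
  where
  open ≡-Reasoning
  distrib : ∀ i j k → - (i * k) + - (j * k) ≡ - ((i + j) * k)
  distrib = solve-∀

χ̃-⊕ : ∀ A B → χ̃ (A ⊕ B) ≡ - (χ̃ A * χ̃ B)
χ̃-⊕ A B = begin
  χ (A ++ B ++ C) - + 1              ≡⟨ cong (_- + 1) (χ-++ A (B ++ C)) ⟩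
  χ A + χ (B ++ C) - + 1             ≡⟨ cong (λ t → χ A + t - + 1) (χ-++ B C) ⟩
  χ A + (χ B + χ C) - + 1            ≡⟨ cong (λ t → χ A + (χ B + t) - + 1) (χ-joinFaces A B) ⟩
  χ A + (χ B + - (χ A * χ B)) - + 1  ≡⟨ factor (χ A) (χ B) ⟩
  - (χ̃ A * χ̃ B)                      ∎
  where
  open ≡-Reasoning
  C = concatMap (λ a → map (a ∪_) B) A
  factor : ∀ i j → i + (j + - (i * j)) - + 1 ≡ - ((i - + 1) * (j - + 1))
  factor = solve-∀

⊕-nonemptyˡ : ∀ {A} B → A ≢ [] → A ⊕ B ≢ []
⊕-nonemptyˡ {[]} B A≢[] = ⊥-elim (A≢[] refl)
⊕-nonemptyˡ {x ∷ A} B _ ()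

⊕-nonemptyʳ : ∀ A {B} → B ≢ [] → A ⊕ B ≢ []
⊕-nonemptyʳ (x ∷ A) _ ()
⊕-nonemptyʳ [] {[]} B≢[] = ⊥-elim (B≢[] refl)
⊕-nonemptyʳ [] {y ∷ B} _ ()

-- The emptiness and reduced Euler characteristic of a (d - 1)-sphere.
record EulerSphere (d : ℕ) (L : Complex) : Set where
  constructor eulerSphere
  field
    nonempty : 0 < d → L ≢ []
    empty : d ≡ 0 → L ≡ []
    χ̃-sphere : χ̃ L ≡ -1^ suc d

open EulerSphere

eulerSphere-resp-set : ∀ {d} → Unique K → Unique L → K ∼[ set ] L → EulerSphere d K → EulerSphere d L
eulerSphere-resp-set {K} {L} uK uL K∼L S = eulerSphere
  (λ 0<d L≡[] → nonempty S 0<d (∉⇒≡[] λ x∈K → ∉[] (subst (_ ∈_) L≡[] (Equivalence.to K∼L x∈K))))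
  (λ d≡0 → ∉⇒≡[] λ x∈L → ∉[] (subst (_ ∈_) (empty S d≡0) (Equivalence.from K∼L x∈L)))
  (≡-trans (cong (_- + 1) (sym (χ-resp-set uK uL K∼L))) (χ̃-sphere S))

eulerSphere-⊕ : ∀ {A B} → EulerSphere m A → EulerSphere n B → EulerSphere (m ℕ.+ n) (A ⊕ B)
eulerSphere-⊕ {m} {n} {A} {B} SA SB = eulerSphere (nonempty-⊕ SA) empty-⊕ χ̃-⊕-sphere
  where
  nonempty-⊕ : ∀ {k} → EulerSphere k A → 0 < k ℕ.+ n → A ⊕ B ≢ []
  nonempty-⊕ {zero} _ = ⊕-nonemptyʳ A ∘ nonempty SB
  nonempty-⊕ {suc _} SA′ _ = ⊕-nonemptyˡ B (nonempty SA′ (s≤s z≤n))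
  empty-⊕ : m ℕ.+ n ≡ 0 → A ⊕ B ≡ []
  empty-⊕ m+n≡0 with empty SA (ℕ.m+n≡0⇒m≡0 m m+n≡0) | empty SB (ℕ.m+n≡0⇒n≡0 m m+n≡0)
  ... | refl | refl = refl
  χ̃-⊕-sphere : χ̃ (A ⊕ B) ≡ -1^ suc (m ℕ.+ n)
  χ̃-⊕-sphere = begin
    χ̃ (A ⊕ B)                        ≡⟨ χ̃-⊕ A B ⟩
    - (χ̃ A * χ̃ B)                    ≡⟨ cong₂ (λ i j → - (i * j)) (χ̃-sphere SA) (χ̃-sphere SB) ⟩
    - (-1^ suc m * -1^ suc n)        ≡⟨ cong -_ (sym (-1^-+ (suc m) (suc n))) ⟩
    - -1^ (suc m ℕ.+ suc n)          ≡⟨ cong (-_ ∘ -1^_ ∘ suc) (ℕ.+-suc m n) ⟩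
    - -1^ suc (suc (m ℕ.+ n))        ≡⟨ cong -_ (-1^-2+ (m ℕ.+ n)) ⟩
    - -1^ (m ℕ.+ n)                  ≡⟨ sym (-1^-suc (m ℕ.+ n)) ⟩
    -1^ suc (m ℕ.+ n)                ∎
    where open ≡-Reasoning

subsets : Face → List Face
subsets [] = [] ∷ []
subsets (v ∷ x) = map (v ∷_) (subsets x) ++ subsets x

∈-subsets⁻ : ∀ x → y ∈ subsets x → y ⊑ x × (Increasing x → Increasing y)
∈-subsets⁻ [] (here refl) = [] , λ _ → []
∈-subsets⁻ (v ∷ x) y∈ with ∈-++⁻ (map (v ∷_) (subsets x)) y∈
... | inj₂ y∈x with ∈-subsets⁻ x y∈x
...   | y⊑x , iy = ⊑-trans y⊑x ⊑-∷ , λ { (_ ∷ ix) → iy ix }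
∈-subsets⁻ (v ∷ x) y∈ | inj₁ v∷y∈ with ∈-map⁻ (v ∷_) v∷y∈
... | y , y∈x , refl with ∈-subsets⁻ x y∈x
...   | y⊑x , iy = here refl ∷ ⊑-trans y⊑x ⊑-∷ , λ { (v<x ∷ ix) → All.map (All.lookup v<x) y⊑x ∷ iy ix }

[]∈subsets : ∀ x → [] ∈ subsets x
[]∈subsets [] = here refl
[]∈subsets (v ∷ x) = ∈-++⁺ʳ _ ([]∈subsets x)

∈-subsets⁺ : ∀ x → Increasing x → Increasing y → y ⊑ x → y ∈ subsets x
∈-subsets⁺ {[]} x _ _ _ = []∈subsets x
∈-subsets⁺ {u ∷ y} (v ∷ x) (v<x ∷ ix) (u<y ∷ iy) (u∈v∷x ∷ y⊑v∷x) with u ℕ.≟ v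
... | yes refl = ∈-++⁺ˡ (∈-map⁺ (v ∷_) (∈-subsets⁺ x ix iy (All.zipWith drop-v (u<y , y⊑v∷x))))
  where
  drop-v : ∀ {w} → v < w × w ∈ v ∷ x → w ∈ x
  drop-v (v<w , here refl) = ⊥-elim (ℕ.<-irrefl refl v<w)
  drop-v (_ , there w∈x) = w∈x
... | no u≢v = ∈-++⁺ʳ _ (∈-subsets⁺ x ix (u<y ∷ iy) (u∈x ∷ All.zipWith drop-v (u<y , y⊑v∷x)))
  where
  u∈x : u ∈ x
  u∈x = ∈-∷-≢ u≢v u∈v∷x
  drop-v : ∀ {w} → u < w × w ∈ v ∷ x → w ∈ x
  drop-v (u<w , here refl) = ⊥-elim (ℕ.<-asym u<w (All.lookup v<x u∈x))
  drop-v (_ , there w∈x) = w∈x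

unique-subsets : ∀ x → Increasing x → Unique (subsets x)
unique-subsets [] _ = [] ∷ []
unique-subsets (v ∷ x) (v<x ∷ ix) =
  Unique.++⁺ (Unique.map⁺ (λ { refl → refl }) (unique-subsets x ix)) (unique-subsets x ix) v∉subsets
  where
  v∉subsets : Disjoint (map (v ∷_) (subsets x)) (subsets x)
  v∉subsets (v∷y∈ , v∷y∈subsets) with ∈-map⁻ (v ∷_) v∷y∈
  ... | _ , _ , refl = ℕ.<-irrefl refl (All.lookup v<x (All.lookup (proj₁ (∈-subsets⁻ x v∷y∈subsets)) (here refl)))

-- Adding a fixed vertex to every subset flips the sign of ω, so these cancel in pairs.
χ-subsets : ∀ v x → χ (subsets (v ∷ x)) ≡ + 0
χ-subsets v x = begin
  χ (map (v ∷_) (subsets x) ++ subsets x)         ≡⟨ χ-++ (map (v ∷_) (subsets x)) (subsets x) ⟩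
  χ (map (v ∷_) (subsets x)) + χ (subsets x)      ≡⟨ cong (_+ χ (subsets x)) (χ-map-∷ (subsets x)) ⟩
  - χ (subsets x) + χ (subsets x)                 ≡⟨ ℤ.+-inverseˡ (χ (subsets x)) ⟩
  + 0                                             ∎
  where
  open ≡-Reasoning
  χ-map-∷ : ∀ L → χ (map (v ∷_) L) ≡ - χ L
  χ-map-∷ [] = refl
  χ-map-∷ (y ∷ L) = ≡-trans (cong₂ _+_ (cong -_ (-1^-suc (length y))) (χ-map-∷ L))
                            (sym (ℤ.neg-distrib-+ (ω y) (χ L)))

∂ : Face → Complex
∂ x = filter (λ y → ¬? (y ≟ []) ×-dec ¬? (y ≟ x)) (subsets x)

∈-∂⁻ : Increasing x → y ∈ ∂ x → Increasing y × y ⊑ x × y ≢ [] × y ≢ x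
∈-∂⁻ {x} ix y∈∂x with ∈-filter⁻ (λ y → ¬? (y ≟ []) ×-dec ¬? (y ≟ x)) y∈∂x
... | y∈subsets , y≢[] , y≢x with ∈-subsets⁻ x y∈subsets
...   | y⊑x , iy = iy ix , y⊑x , y≢[] , y≢x

∈-∂⁺ : Increasing x → Increasing y → y ⊑ x → y ≢ [] → y ≢ x → y ∈ ∂ x
∈-∂⁺ {x} ix iy y⊑x y≢[] y≢x =
  ∈-filter⁺ (λ y → ¬? (y ≟ []) ×-dec ¬? (y ≟ x)) (∈-subsets⁺ x ix iy y⊑x) (y≢[] , y≢x)

unique-∂ : Increasing x → Unique (∂ x)
unique-∂ {x} ix = Unique.filter⁺ (λ y → ¬? (y ≟ []) ×-dec ¬? (y ≟ x)) (unique-subsets x ix)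

subsets-∼ : Increasing x → subsets x ∼[ set ] ([] ∷ x ∷ ∂ x)
subsets-∼ {x} ix = mk⇔ to from
  where
  to : y ∈ subsets x → y ∈ [] ∷ x ∷ ∂ x
  to {y} y∈ with y ≟ [] | y ≟ x
  ... | yes refl | _ = here refl
  ... | no _ | yes refl = there (here refl)
  ... | no y≢[] | no y≢x = there (there (∈-filter⁺ (λ y → ¬? (y ≟ []) ×-dec ¬? (y ≟ x)) y∈ (y≢[] , y≢x)))
  from : y ∈ [] ∷ x ∷ ∂ x → y ∈ subsets x
  from (here refl) = []∈subsets x
  from (there (here refl)) = ∈-subsets⁺ x ix ix ⊑-refl
  from (there (there y∈∂x)) = let (iy , y⊑x , _) = ∈-∂⁻ ix y∈∂x in ∈-subsets⁺ x ix iy y⊑x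

unique-[]∷∷∂ : Increasing (v ∷ x) → Unique ([] ∷ (v ∷ x) ∷ ∂ (v ∷ x))
unique-[]∷∷∂ ix =
  ((λ ()) ∷ All.tabulate (λ y∈∂x []≡y → proj₁ (proj₂ (proj₂ (∈-∂⁻ ix y∈∂x))) (sym []≡y))) ∷
  All.tabulate (λ y∈∂x x≡y → proj₂ (proj₂ (proj₂ (∈-∂⁻ ix y∈∂x))) (sym x≡y)) ∷
  unique-∂ ix

χ̃-∂ : Increasing (v ∷ x) → χ̃ (∂ (v ∷ x)) ≡ -1^ suc (length x)
χ̃-∂ {v} {x} ix = begin
  χ (∂ s) - + 1                               ≡⟨ rearrange (ω s) (χ (∂ s)) ⟩
  - ω s + (ω [] + (ω s + χ (∂ s)))            ≡⟨ cong (_+_ (- ω s)) (sym χ-subsets-∼) ⟩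
  - ω s + + 0                                 ≡⟨ ℤ.+-identityʳ (- ω s) ⟩
  - ω s                                       ≡⟨ ℤ.neg-involutive _ ⟩
  -1^ suc (length x)                          ∎
  where
  open ≡-Reasoning
  s = v ∷ x
  χ-subsets-∼ : + 0 ≡ ω [] + (ω s + χ (∂ s))
  χ-subsets-∼ = ≡-trans (sym (χ-subsets v x)) (χ-resp-set (unique-subsets s ix) (unique-[]∷∷∂ ix) (subsets-∼ ix))
  rearrange : ∀ i j → j - + 1 ≡ - i + (- (+ 1) + (i + j))
  rearrange = solve-∀

∂-vertex : ∂ (v ∷ []) ≡ []
∂-vertex {v} = ∉⇒≡[] λ y∈∂v → let (iy , y⊑v , y≢[] , y≢v) = ∈-∂⁻ {x = v ∷ []} ([] ∷ []) y∈∂v in y≢v (vertex iy y⊑v y≢[])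
  where
  vertex : Increasing y → y ⊑ (v ∷ []) → y ≢ [] → y ≡ v ∷ []
  vertex {[]} _ _ y≢[] = ⊥-elim (y≢[] refl)
  vertex {_ ∷ _} iy y⊑v@(here refl ∷ _) _ = ⊑-antisym iy ([] ∷ []) y⊑v (here refl ∷ [])

eulerSphere-∂ : ∀ x → Increasing x → EulerSphere (ℕ.pred (length x)) (∂ x)
eulerSphere-∂ [] _ = eulerSphere (λ ()) (λ _ → refl) refl
eulerSphere-∂ (v ∷ []) ix = eulerSphere (λ ()) (λ _ → ∂-vertex {v}) (χ̃-∂ ix)
eulerSphere-∂ (v ∷ w ∷ x) ix = eulerSphere (λ _ → v∉∂) (λ ()) (χ̃-∂ ix)
  where
  v∉∂ : ∂ (v ∷ w ∷ x) ≢ []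
  v∉∂ ∂≡[] = ∉[] (subst (v ∷ [] ∈_) ∂≡[] (∈-∂⁺ ix ([] ∷ []) (here refl ∷ []) (λ ()) (λ ())))

module _ (cK : IsComplex K) where

  complex-unique : Unique K
  complex-unique = proj₁ cK

  complex-increasing : x ∈ K → Increasing x
  complex-increasing x∈K = linked⇒increasing (proj₂ (All.lookup (proj₁ (proj₂ cK)) x∈K))

  complex-nonempty : x ∈ K → x ≢ []
  complex-nonempty x∈K = proj₁ (All.lookup (proj₁ (proj₂ cK)) x∈K)

  complex-downClosed : x ∈ K → Increasing y → y ≢ [] → y ⊑ x → y ∈ K
  complex-downClosed x∈K iy y≢[] = proj₂ (proj₂ cK) x∈K (y≢[] , AllPairs⇒Linked iy)

-- Faces of the augmented complex K ∪ {∅}; the empty face has link K.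
infix 4 _∈₀_
_∈₀_ : Face → Complex → Set
x ∈₀ K = x ≡ [] ⊎ x ∈ K

∈₀-intro : (x ≢ [] → x ∈ K) → x ∈₀ K
∈₀-intro {x} x∈K with x ≟ []
... | yes x≡[] = inj₁ x≡[]
... | no x≢[] = inj₂ (x∈K x≢[])

∈₀-nonempty : x ∈₀ K → x ≢ [] → x ∈ K
∈₀-nonempty (inj₁ x≡[]) x≢[] = ⊥-elim (x≢[] x≡[])
∈₀-nonempty (inj₂ x∈K) _ = x∈K

module _ (cK : IsComplex K) where

  complex-increasing₀ : x ∈₀ K → Increasing x
  complex-increasing₀ (inj₁ refl) = []
  complex-increasing₀ (inj₂ x∈K) = complex-increasing cK x∈K

  complex-downClosed₀ : x ∈₀ K → Increasing y → y ⊑ x → y ∈₀ K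
  complex-downClosed₀ x∈₀K iy y⊑x = ∈₀-intro λ y≢[] →
    complex-downClosed cK (∈₀-nonempty x∈₀K λ { refl → y≢[] (⊑-[] y⊑x) }) iy y≢[] y⊑x

isComplex-∂ : Increasing x → IsComplex (∂ x)
isComplex-∂ {x} ix = unique-∂ ix , All.tabulate face , downClosed
  where
  face : y ∈ ∂ x → IsFace y
  face y∈∂x = let (iy , _ , y≢[] , _) = ∈-∂⁻ ix y∈∂x in y≢[] , AllPairs⇒Linked iy
  downClosed : y ∈ ∂ x → IsFace z → z ⊑ y → z ∈ ∂ x
  downClosed y∈∂x (z≢[] , lz) z⊑y with ∈-∂⁻ ix y∈∂x
  ... | iy , y⊑x , _ , y≢x = ∈-∂⁺ ix (linked⇒increasing lz) (⊑-trans z⊑y y⊑x) z≢[]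
        λ { refl → y≢x (⊑-antisym iy ix y⊑x z⊑y) }

∈-S⁻ : y ∈ S K x → y ∈ K × (∃ λ z → z ∈ K × x ⊑ z × y ⊑ z) × ¬ x ⊑ y
∈-S⁻ {K = K} {x} y∈S with ∈-filter⁻ (λ y → any? (y ⊑?_) (U K x) ×-dec ¬? (x ⊑? y)) y∈S
... | y∈K , y⊑star , x⋢y with find y⊑star
...   | z , z∈U , y⊑z = y∈K , (z , proj₁ (∈-filter⁻ (x ⊑?_) {xs = K} z∈U) , proj₂ (∈-filter⁻ (x ⊑?_) {xs = K} z∈U) , y⊑z) , x⋢y

∈-S⁺ : y ∈ K → z ∈ K → x ⊑ z → y ⊑ z → ¬ x ⊑ y → y ∈ S K x
∈-S⁺ {K = K} {x = x} y∈K z∈K x⊑z y⊑z x⋢y =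
  ∈-filter⁺ (λ y → any? (y ⊑?_) (U K x) ×-dec ¬? (x ⊑? y)) y∈K (lose (∈-filter⁺ (x ⊑?_) z∈K x⊑z) y⊑z , x⋢y)

isComplex-S : ∀ x → IsComplex K → IsComplex (S K x)
isComplex-S {K} x cK@(uK , faces , downClosed) =
  Unique.filter⁺ (λ y → any? (y ⊑?_) (U K x) ×-dec ¬? (x ⊑? y)) uK ,
  All.tabulate (All.lookup faces ∘ proj₁ ∘ ∈-S⁻) ,
  downClosed-S
  where
  downClosed-S : y ∈ S K x → IsFace z → z ⊑ y → z ∈ S K x
  downClosed-S y∈S fz z⊑y with ∈-S⁻ y∈S
  ... | y∈K , (w , w∈K , x⊑w , y⊑w) , x⋢y =
    ∈-S⁺ (downClosed y∈K fz z⊑y) w∈K x⊑w (⊑-trans z⊑y y⊑w) (λ x⊑z → x⋢y (⊑-trans x⊑z z⊑y))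

Link : Complex → Face → Complex
Link K z = filter (λ u → All.all? (λ v → ¬? (v ∈? z)) u ×-dec (z ∪ u ∈ᶠ? K)) K

∈-Link⁻ : ∀ K z → u ∈ Link K z → u ∈ K × Disjoint u z × z ∪ u ∈ K
∈-Link⁻ K z u∈Lk with ∈-filter⁻ (λ u → All.all? (λ v → ¬? (v ∈? z)) u ×-dec (z ∪ u ∈ᶠ? K)) u∈Lk
... | u∈K , u∉z , z∪u∈K = u∈K , (λ (v∈u , v∈z) → All.lookup u∉z v∈u v∈z) , z∪u∈K

∈-Link⁺ : u ∈ K → Disjoint u z → z ∪ u ∈ K → u ∈ Link K z
∈-Link⁺ {K = K} {z = z} u∈K u#z z∪u∈K =
  ∈-filter⁺ (λ u → All.all? (λ v → ¬? (v ∈? z)) u ×-dec (z ∪ u ∈ᶠ? K)) u∈K (All.tabulate (λ v∈u v∈z → u#z (v∈u , v∈z)) , z∪u∈K)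

unique-Link : ∀ z → Unique K → Unique (Link K z)
unique-Link {K} z = Unique.filter⁺ (λ u → All.all? (λ v → ¬? (v ∈? z)) u ×-dec (z ∪ u ∈ᶠ? K))

Link-[] : Link K [] ∼[ set ] K
Link-[] {K} = mk⇔ (proj₁ ∘ ∈-Link⁻ K []) (λ u∈K → ∈-Link⁺ u∈K (λ ()) u∈K)

isComplex-Link : ∀ z → Increasing z → IsComplex K → IsComplex (Link K z)
isComplex-Link {K} z iz cK =
  unique-Link z (complex-unique cK) ,
  All.tabulate (λ u∈Lk → let u∈K = proj₁ (∈-Link⁻ K z u∈Lk) in complex-nonempty cK u∈K , AllPairs⇒Linked (complex-increasing cK u∈K)) ,
  downClosed
  where
  downClosed : ∀ {u y} → u ∈ Link K z → IsFace y → y ⊑ u → y ∈ Link K z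
  downClosed {u} {y} u∈Lk (y≢[] , ly) y⊑u with ∈-Link⁻ K z u∈Lk
  ... | u∈K , u#z , z∪u∈K = ∈-Link⁺ (complex-downClosed cK u∈K iy y≢[] y⊑u) y#z
        (complex-downClosed cK z∪u∈K (increasing-∪ iz iy (disjoint-sym y#z)) (∪-nonemptyʳ z y≢[])
          (∪-⊑ (⊑-∪ˡ z u) (⊑-trans y⊑u (⊑-∪ʳ z u))))
    where
    iy = linked⇒increasing ly
    y#z : Disjoint y z
    y#z (v∈y , v∈z) = u#z (All.lookup y⊑u v∈y , v∈z)

∈₀-Link⇒∈₀ : ∀ K z → u ∈₀ Link K z → u ∈₀ K
∈₀-Link⇒∈₀ K z (inj₁ u≡[]) = inj₁ u≡[]
∈₀-Link⇒∈₀ K z (inj₂ u∈Lk) = inj₂ (proj₁ (∈-Link⁻ K z u∈Lk))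

∈₀-Link⇒disjoint : ∀ K z → u ∈₀ Link K z → Disjoint u z
∈₀-Link⇒disjoint K z (inj₁ refl) (() , _)
∈₀-Link⇒disjoint K z (inj₂ u∈Lk) = proj₁ (proj₂ (∈-Link⁻ K z u∈Lk))

∈₀-Link⇒∪∈₀ : ∀ K z → z ∈₀ K → u ∈₀ Link K z → z ∪ u ∈₀ K
∈₀-Link⇒∪∈₀ K z z∈₀K (inj₁ refl) = subst (_∈₀ K) (sym (∪-identityʳ z)) z∈₀K
∈₀-Link⇒∪∈₀ K z _ (inj₂ u∈Lk) = inj₂ (proj₂ (proj₂ (∈-Link⁻ K z u∈Lk)))

unique-map⁺ : ∀ {A B : Set} {f : A → B} {xs : List A} →
              (∀ {x y} → x ∈ xs → y ∈ xs → f x ≡ f y → x ≡ y) → Unique xs → Unique (map f xs)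
unique-map⁺ {xs = []} _ [] = []
unique-map⁺ {xs = x ∷ xs} f-inj (x∉xs ∷ uxs) =
  All-map⁺ (All.tabulate λ y∈xs fx≡fy → All.lookup x∉xs y∈xs (f-inj (here refl) (there y∈xs) fx≡fy)) ∷
  unique-map⁺ (λ x∈ y∈ → f-inj (there x∈) (there y∈)) uxs

increasing-∪₀ : IsComplex K → a ∈₀ K → u ∈₀ K → Disjoint u a → Increasing (a ∪ u)
increasing-∪₀ cK a∈₀K u∈₀K u#a =
  increasing-∪ (complex-increasing₀ cK a∈₀K) (complex-increasing₀ cK u∈₀K) (disjoint-sym u#a)

disjoint₀ : ∀ {A B} → DisjointVertices A B → a ∈₀ A → b ∈₀ B → Disjoint a b
disjoint₀ A#B (inj₁ refl) _ (() , _)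
disjoint₀ A#B (inj₂ _) (inj₁ refl) (_ , ())
disjoint₀ A#B (inj₂ a∈A) (inj₂ b∈B) (v∈a , v∈b) = A#B a∈A b∈B v∈a v∈b

∈-joinFaces⁻ : ∀ A B → x ∈ concatMap (λ a → map (a ∪_) B) A → ∃ λ a → ∃ λ b → a ∈ A × b ∈ B × x ≡ a ∪ b
∈-joinFaces⁻ A B x∈ with find (∈-concatMap⁻ (λ a → map (a ∪_) B) {xs = A} x∈)
... | a , a∈A , x∈a∪B with ∈-map⁻ (a ∪_) x∈a∪B
...   | b , b∈B , x≡a∪b = a , b , a∈A , b∈B , x≡a∪b

∈-⊕⁻ : ∀ A B → x ∈ A ⊕ B → ∃ λ a → ∃ λ b → a ∈₀ A × b ∈₀ B × x ≡ a ∪ b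
∈-⊕⁻ {x} A B x∈ with ∈-++⁻ A x∈
... | inj₁ x∈A = x , [] , inj₂ x∈A , inj₁ refl , sym (∪-identityʳ x)
... | inj₂ x∈ with ∈-++⁻ B x∈
...   | inj₁ x∈B = [] , x , inj₁ refl , inj₂ x∈B , refl
...   | inj₂ x∈ with ∈-joinFaces⁻ A B x∈
...     | a , b , a∈A , b∈B , x≡a∪b = a , b , inj₂ a∈A , inj₂ b∈B , x≡a∪b

∈-⊕⁺ : ∀ {A B} → a ∈₀ A → b ∈₀ B → a ∪ b ≢ [] → a ∪ b ∈ A ⊕ B
∈-⊕⁺ (inj₁ refl) (inj₁ refl) a∪b≢[] = ⊥-elim (a∪b≢[] refl)
∈-⊕⁺ {A = A} (inj₁ refl) (inj₂ b∈B) _ = ∈-++⁺ʳ A (∈-++⁺ˡ b∈B)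
∈-⊕⁺ {a} (inj₂ a∈A) (inj₁ refl) _ = subst (_∈ _) (sym (∪-identityʳ a)) (∈-++⁺ˡ a∈A)
∈-⊕⁺ {a} {b} {A} {B} (inj₂ a∈A) (inj₂ b∈B) _ =
  ∈-++⁺ʳ A (∈-++⁺ʳ B (∈-concatMap⁺ (λ a → map (a ∪_) B) (lose a∈A (∈-map⁺ (a ∪_) b∈B))))

⊕-faces-nonempty : ∀ {A B} → (∀ {x} → x ∈ A → x ≢ []) → (∀ {x} → x ∈ B → x ≢ []) → x ∈ A ⊕ B → x ≢ []
⊕-faces-nonempty {A = A} {B} A-nonempty B-nonempty x∈ with ∈-⊕⁻ A B x∈
... | a , b , inj₂ a∈A , _ , refl = ∪-nonemptyˡ b (A-nonempty a∈A)
... | a , b , inj₁ refl , inj₂ b∈B , refl = B-nonempty b∈B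
... | a , b , inj₁ refl , inj₁ refl , refl = λ _ → []∉ x∈
  where
  []∉ : [] ∉ A ⊕ B
  []∉ []∈ with ∈-++⁻ A []∈
  ... | inj₁ []∈A = A-nonempty []∈A refl
  ... | inj₂ []∈ with ∈-++⁻ B []∈
  ...   | inj₁ []∈B = B-nonempty []∈B refl
  ...   | inj₂ []∈ with ∈-joinFaces⁻ A B []∈
  ...     | a , b , a∈A , _ , []≡a∪b = ∪-nonemptyˡ b (A-nonempty a∈A) (sym []≡a∪b)

module _ {A B} (cA : IsComplex A) (cB : IsComplex B) (A#B : DisjointVertices A B) where

  unique-⊕ : Unique (A ⊕ B)
  unique-⊕ = Unique.++⁺ (complex-unique cA) (Unique.++⁺ (complex-unique cB) (unique-joinFaces A (complex-unique cA) id) B#C) A#B++C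
    where
    C = concatMap (λ a → map (a ∪_) B) A
    unique-joinFaces : ∀ A′ → Unique A′ → (∀ {a} → a ∈ A′ → a ∈ A) → Unique (concatMap (λ a → map (a ∪_) B) A′)
    unique-joinFaces [] _ _ = []
    unique-joinFaces (a ∷ A′) (a∉A′ ∷ uA′) A′⊆A =
      Unique.++⁺ unique-a∪B (unique-joinFaces A′ uA′ (A′⊆A ∘ there)) a∪B#rest
      where
      a∈A = A′⊆A (here refl)
      unique-a∪B : Unique (map (a ∪_) B)
      unique-a∪B = unique-map⁺ (λ b∈B b′∈B → ∪-cancelʳ (complex-increasing cB b∈B) (complex-increasing cB b′∈B)
                                  (disjoint₀ A#B (inj₂ a∈A) (inj₂ b′∈B)) (disjoint₀ A#B (inj₂ a∈A) (inj₂ b∈B)))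
                               (complex-unique cB)
      a∪B#rest : Disjoint (map (a ∪_) B) (concatMap (λ a → map (a ∪_) B) A′)
      a∪B#rest (x∈a∪B , x∈rest) with ∈-map⁻ (a ∪_) x∈a∪B | ∈-joinFaces⁻ A′ B x∈rest
      ... | b , b∈B , refl | a′ , b′ , a′∈A′ , b′∈B , a∪b≡a′∪b′ =
        All.lookup a∉A′ a′∈A′ (∪-cancelˡ (complex-increasing cA a∈A) (complex-increasing cA a′∈A)
          (disjoint₀ A#B (inj₂ a∈A) (inj₂ b′∈B)) (disjoint₀ A#B (inj₂ a′∈A) (inj₂ b∈B)) a∪b≡a′∪b′)
        where a′∈A = A′⊆A (there a′∈A′)
    B#C : Disjoint B C
    B#C (x∈B , x∈C) with ∈-joinFaces⁻ A B x∈C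
    ... | a , b , a∈A , b∈B , refl with ≢[]⇒∈ (complex-nonempty cA a∈A)
    ...   | v , v∈a = A#B a∈A x∈B v∈a (∈-∪⁺ˡ b v∈a)
    A#B++C : Disjoint A (B ++ C)
    A#B++C (x∈A , x∈B++C) with ≢[]⇒∈ (complex-nonempty cA x∈A) | ∈-++⁻ B x∈B++C
    ... | v , v∈x | inj₁ x∈B = A#B x∈A x∈B v∈x v∈x
    ... | _ | inj₂ x∈C with ∈-joinFaces⁻ A B x∈C
    ...   | a , b , a∈A , b∈B , refl with ≢[]⇒∈ (complex-nonempty cB b∈B)
    ...     | v , v∈b = A#B x∈A b∈B (∈-∪⁺ʳ a v∈b) v∈b

  increasing-∪-sides : a ∈₀ A → b ∈₀ B → Increasing (a ∪ b)
  increasing-∪-sides a∈₀A b∈₀B =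
    increasing-∪ (complex-increasing₀ cA a∈₀A) (complex-increasing₀ cB b∈₀B) (disjoint₀ A#B a∈₀A b∈₀B)

  increasing-⊕ : x ∈ A ⊕ B → Increasing x
  increasing-⊕ x∈ with ∈-⊕⁻ A B x∈
  ... | a , b , a∈₀A , b∈₀B , refl = increasing-∪-sides a∈₀A b∈₀B

  isComplex-⊕ : IsComplex (A ⊕ B)
  isComplex-⊕ = unique-⊕ ,
    All.tabulate (λ x∈ → ⊕-faces-nonempty (complex-nonempty cA) (complex-nonempty cB) x∈ , AllPairs⇒Linked (increasing-⊕ x∈)) ,
    downClosed
    where
    downClosed : ∀ {x y} → x ∈ A ⊕ B → IsFace y → y ⊑ x → y ∈ A ⊕ B
    downClosed {y = y} x∈ (y≢[] , ly) y⊑x with ∈-⊕⁻ A B x∈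
    ... | a , b , a∈₀A , b∈₀B , refl =
      subst (_∈ A ⊕ B) (sym y≡) (∈-⊕⁺ y∩a∈₀A y∩b∈₀B λ e → y≢[] (≡-trans y≡ e))
      where
      iy = linked⇒increasing ly
      y∩a∈₀A : y ∩ a ∈₀ A
      y∩a∈₀A = complex-downClosed₀ cA a∈₀A (increasing-∩ a iy) (∩-⊑ʳ y a)
      y∩b∈₀B : y ∩ b ∈₀ B
      y∩b∈₀B = complex-downClosed₀ cB b∈₀B (increasing-∩ b iy) (∩-⊑ʳ y b)
      y≡ : y ≡ y ∩ a ∪ y ∩ b
      y≡ = ⊑-antisym iy
        (increasing-∪ (increasing-∩ a iy) (increasing-∩ b iy)
          (λ (v∈y∩a , v∈y∩b) → disjoint₀ A#B a∈₀A b∈₀B (proj₂ (∈-∩⁻ y a v∈y∩a) , proj₂ (∈-∩⁻ y b v∈y∩b))))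
        (All.tabulate λ v∈y → [ ∈-∪⁺ˡ (y ∩ b) ∘ ∈-∩⁺ a v∈y , ∈-∪⁺ʳ (y ∩ a) ∘ ∈-∩⁺ b v∈y ] (∈-∪⁻ a b (All.lookup y⊑x v∈y)))
        (∪-⊑ (∩-⊑ˡ y a) (∩-⊑ˡ y b))

  ∪-regroup : a ∈₀ A → b ∈₀ B → c ∈₀ A → d ∈₀ B → Disjoint c a → Disjoint d b →
              a ∪ b ∪ (c ∪ d) ≡ a ∪ c ∪ (b ∪ d)
  ∪-regroup {a} {b} {c} {d} a∈₀A b∈₀B c∈₀A d∈₀B c#a d#b = ∪-interchange a b c d
    (increasing-∪ (increasing-∪-sides a∈₀A b∈₀B) (increasing-∪-sides c∈₀A d∈₀B)
      (disjoint-∪ˡ (disjoint-∪ʳ (disjoint-sym c#a) (disjoint₀ A#B a∈₀A d∈₀B))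
                   (disjoint-∪ʳ (disjoint-sym (disjoint₀ A#B c∈₀A b∈₀B)) (disjoint-sym d#b))))
    (increasing-∪ (increasing-∪₀ cA a∈₀A c∈₀A c#a) (increasing-∪₀ cB b∈₀B d∈₀B d#b)
      (disjoint-∪ˡ (disjoint-∪ʳ (disjoint₀ A#B a∈₀A b∈₀B) (disjoint₀ A#B a∈₀A d∈₀B))
                   (disjoint-∪ʳ (disjoint₀ A#B c∈₀A b∈₀B) (disjoint₀ A#B c∈₀A d∈₀B))))

  -- A face of A ⊕ B splits uniquely along the two vertex sets, hence so does a face of a link.
  Link-⊕⁻ : a ∈₀ A → b ∈₀ B → u ∈ Link (A ⊕ B) (a ∪ b) → u ∈ Link A a ⊕ Link B b
  Link-⊕⁻ {a} {b} a∈₀A b∈₀B u∈Lk with ∈-Link⁻ (A ⊕ B) (a ∪ b) u∈Lk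
  ... | u∈A⊕B , u#a∪b , a∪b∪u∈A⊕B with ∈-⊕⁻ A B u∈A⊕B | ∈-⊕⁻ A B a∪b∪u∈A⊕B
  ... | u₁ , u₂ , u₁∈₀A , u₂∈₀B , refl | c , d , c∈₀A , d∈₀B , a∪b∪u≡c∪d =
    ∈-⊕⁺ (u₁∈₀Link c≡a∪u₁) (u₂∈₀Link d≡b∪u₂) (⊕-faces-nonempty (complex-nonempty cA) (complex-nonempty cB) u∈A⊕B)
    where
    u₁#a : Disjoint u₁ a
    u₁#a (v∈u₁ , v∈a) = u#a∪b (∈-∪⁺ˡ u₂ v∈u₁ , ∈-∪⁺ˡ b v∈a)
    u₂#b : Disjoint u₂ b
    u₂#b (v∈u₂ , v∈b) = u#a∪b (∈-∪⁺ʳ u₁ v∈u₂ , ∈-∪⁺ʳ a v∈b)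
    c∪d≡ : c ∪ d ≡ a ∪ u₁ ∪ (b ∪ u₂)
    c∪d≡ = ≡-trans (sym a∪b∪u≡c∪d) (∪-regroup a∈₀A b∈₀B u₁∈₀A u₂∈₀B u₁#a u₂#b)
    c≡a∪u₁ : c ≡ a ∪ u₁
    c≡a∪u₁ = ∪-cancelˡ (complex-increasing₀ cA c∈₀A) (increasing-∪₀ cA a∈₀A u₁∈₀A u₁#a)
      (disjoint-∪ʳ (disjoint₀ A#B c∈₀A b∈₀B) (disjoint₀ A#B c∈₀A u₂∈₀B))
      (disjoint-∪ˡ (disjoint₀ A#B a∈₀A d∈₀B) (disjoint₀ A#B u₁∈₀A d∈₀B)) c∪d≡
    d≡b∪u₂ : d ≡ b ∪ u₂
    d≡b∪u₂ = ∪-cancelʳ (complex-increasing₀ cB d∈₀B) (increasing-∪₀ cB b∈₀B u₂∈₀B u₂#b)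
      (disjoint-∪ʳ (disjoint₀ A#B c∈₀A b∈₀B) (disjoint₀ A#B c∈₀A u₂∈₀B))
      (disjoint-∪ˡ (disjoint₀ A#B a∈₀A d∈₀B) (disjoint₀ A#B u₁∈₀A d∈₀B)) c∪d≡
    u₁∈₀Link : c ≡ a ∪ u₁ → u₁ ∈₀ Link A a
    u₁∈₀Link refl = ∈₀-intro λ u₁≢[] →
      ∈-Link⁺ (∈₀-nonempty u₁∈₀A u₁≢[]) u₁#a (∈₀-nonempty c∈₀A (∪-nonemptyʳ a u₁≢[]))
    u₂∈₀Link : d ≡ b ∪ u₂ → u₂ ∈₀ Link B b
    u₂∈₀Link refl = ∈₀-intro λ u₂≢[] →
      ∈-Link⁺ (∈₀-nonempty u₂∈₀B u₂≢[]) u₂#b (∈₀-nonempty d∈₀B (∪-nonemptyʳ b u₂≢[]))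
  Link-⊕⁺ : a ∈₀ A → b ∈₀ B → u ∈ Link A a ⊕ Link B b → u ∈ Link (A ⊕ B) (a ∪ b)
  Link-⊕⁺ {a} {b} a∈₀A b∈₀B u∈ with ∈-⊕⁻ (Link A a) (Link B b) u∈
  ... | u₁ , u₂ , u₁∈₀Lk , u₂∈₀Lk , refl = ∈-Link⁺ u∈A⊕B u#a∪b a∪b∪u∈A⊕B
    where
    u₁∈₀A = ∈₀-Link⇒∈₀ A a u₁∈₀Lk
    u₂∈₀B = ∈₀-Link⇒∈₀ B b u₂∈₀Lk
    u₁#a = ∈₀-Link⇒disjoint A a u₁∈₀Lk
    u₂#b = ∈₀-Link⇒disjoint B b u₂∈₀Lk
    u≢[] : u₁ ∪ u₂ ≢ []
    u≢[] = ⊕-faces-nonempty (complex-nonempty cA ∘ proj₁ ∘ ∈-Link⁻ A a) (complex-nonempty cB ∘ proj₁ ∘ ∈-Link⁻ B b) u∈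
    u∈A⊕B : u₁ ∪ u₂ ∈ A ⊕ B
    u∈A⊕B = ∈-⊕⁺ u₁∈₀A u₂∈₀B u≢[]
    u#a∪b : Disjoint (u₁ ∪ u₂) (a ∪ b)
    u#a∪b = disjoint-∪ˡ (disjoint-∪ʳ u₁#a (disjoint₀ A#B u₁∈₀A b∈₀B))
                        (disjoint-∪ʳ (λ (v∈u₂ , v∈a) → disjoint₀ A#B a∈₀A u₂∈₀B (v∈a , v∈u₂)) u₂#b)
    a∪b∪u∈A⊕B : a ∪ b ∪ (u₁ ∪ u₂) ∈ A ⊕ B
    a∪b∪u∈A⊕B = subst (_∈ A ⊕ B) (sym regroup)
      (∈-⊕⁺ (∈₀-Link⇒∪∈₀ A a a∈₀A u₁∈₀Lk) (∈₀-Link⇒∪∈₀ B b b∈₀B u₂∈₀Lk)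
        (∪-nonemptyʳ (a ∪ b) u≢[] ∘ ≡-trans regroup))
      where regroup = ∪-regroup a∈₀A b∈₀B u₁∈₀A u₂∈₀B u₁#a u₂#b

  Link-⊕ : a ∈₀ A → b ∈₀ B → Link (A ⊕ B) (a ∪ b) ∼[ set ] Link A a ⊕ Link B b
  Link-⊕ a∈₀A b∈₀B = mk⇔ (Link-⊕⁻ a∈₀A b∈₀B) (Link-⊕⁺ a∈₀A b∈₀B)

∂₀-proper : Increasing x → x ≢ [] → y ∈₀ ∂ x → ¬ x ⊑ y
∂₀-proper ix x≢[] (inj₁ refl) x⊑[] = x≢[] (⊑-[] x⊑[])
∂₀-proper ix x≢[] (inj₂ y∈∂x) x⊑y with ∈-∂⁻ ix y∈∂x
... | iy , y⊑x , _ , y≢x = y≢x (⊑-antisym iy ix y⊑x x⊑y)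

⊑⇒∖≡[] : x ⊑ y → x ∖ y ≡ []
⊑⇒∖≡[] {x} {y} x⊑y = ∉⇒≡[] λ v∈x∖y → let (v∈x , v∉y) = ∈-∖⁻ x y v∈x∖y in v∉y (All.lookup x⊑y v∈x)

∈₀-S⁻ : IsComplex K → x ∈ K → z ∈₀ S K x → ∃ λ w → w ∈ K × x ⊑ w × z ⊑ w × ¬ x ⊑ z
∈₀-S⁻ cK x∈K (inj₁ refl) = _ , x∈K , ⊑-refl , [] , λ x⊑[] → complex-nonempty cK x∈K (⊑-[] x⊑[])
∈₀-S⁻ cK x∈K (inj₂ z∈S) = let (_ , (w , w∈K , x⊑w , z⊑w) , x⋢z) = ∈-S⁻ z∈S in w , w∈K , x⊑w , z⊑w , x⋢z

-- For x ∈ K and z in the unit sphere S(x), write s = x ∖ z and t = x ∪ (z ∖ x).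
-- A face of S(x) avoiding z splits into a proper part of s and a face of the link of t.
module _ (cK : IsComplex K) (x∈K : x ∈ K) (z∈₀S : z ∈₀ S K x) where

  private
    ix = complex-increasing cK x∈K
    iz = complex-increasing₀ (isComplex-S x cK) z∈₀S
    s = x ∖ z
    l = z ∖ x
    t = x ∪ l
    is = increasing-∖ z ix
    il = increasing-∖ x iz
    l#x = ∖-disjoint z x
    s#z = ∖-disjoint x z
    it : Increasing t
    it = increasing-∪ ix il (disjoint-sym l#x)
    l⊑z = ∖-⊑ z x
    z⊑t : z ⊑ t
    z⊑t = All.tabulate λ v∈z → [ ∈-∪⁺ˡ l ∘ All.lookup (∩-⊑ʳ z x) , ∈-∪⁺ʳ x ] (∈-∩∖ z x v∈z)
    star = ∈₀-S⁻ cK x∈K z∈₀S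
    x≢[] = complex-nonempty cK x∈K
    c∂ = isComplex-∂ is
    cLk = isComplex-Link t it cK
    s⊑t : s ⊑ t
    s⊑t = ⊑-trans (∖-⊑ x z) (⊑-∪ˡ x l)

    -- s ⊑ u₁ as soon as every vertex of s lies in z ∪ u₁ ∪ u₂, since s avoids z and t avoids u₂
    s⊑-part : ∀ {u₁ u₂} → Disjoint u₂ t → (∀ {v} → v ∈ s → v ∈ z ⊎ v ∈ u₁ ∪ u₂) → s ⊑ u₁
    s⊑-part {u₁} {u₂} u₂#t covered = All.tabulate λ v∈s → case covered v∈s of λ where
      (inj₁ v∈z) → ⊥-elim (s#z (v∈s , v∈z))
      (inj₂ v∈u) → case ∈-∪⁻ u₁ u₂ v∈u of λ where
        (inj₁ v∈u₁) → v∈u₁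
        (inj₂ v∈u₂) → ⊥-elim (u₂#t (v∈u₂ , All.lookup s⊑t v∈s))

    ∂#Link : DisjointVertices (∂ s) (Link K t)
    ∂#Link f∈∂ g∈Lk v∈f v∈g =
      proj₁ (proj₂ (∈-Link⁻ K t g∈Lk)) (v∈g , All.lookup s⊑t (All.lookup (proj₁ (proj₂ (∈-∂⁻ is f∈∂))) v∈f))

  S-link-vertices-nonempty : x ∖ z ≢ []
  S-link-vertices-nonempty s≡[] with star
  ... | _ , _ , _ , _ , x⋢z = x⋢z (All.tabulate λ v∈x →
          [ All.lookup (∩-⊑ʳ x z) , (λ v∈s → ⊥-elim (∉[] (subst (_ ∈_) s≡[] v∈s))) ] (∈-∩∖ x z v∈x))

  S-link-centre∈K : x ∪ (z ∖ x) ∈ K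
  S-link-centre∈K with star
  ... | W , W∈K , x⊑W , z⊑W , _ =
    complex-downClosed cK W∈K it (∪-nonemptyˡ l x≢[]) (∪-⊑ x⊑W (⊑-trans l⊑z z⊑W))

  length-S-link : length z ℕ.+ length (x ∖ z) ≡ length (x ∪ (z ∖ x))
  length-S-link = ≡-trans (sym (length-∪ z s)) (cong length (⊑-antisym (increasing-∪ iz is z#s) it
    (∪-⊑ z⊑t (⊑-trans (∖-⊑ x z) (⊑-∪ˡ x l)))
    (∪-⊑ (All.tabulate λ v∈x → [ ∈-∪⁺ˡ s ∘ All.lookup (∩-⊑ʳ x z) , ∈-∪⁺ʳ z ] (∈-∩∖ x z v∈x)) (⊑-trans l⊑z (⊑-∪ˡ z s)))))
    where
    z#s = disjoint-sym s#z

  unique-∂⊕Link : Unique (∂ (x ∖ z) ⊕ Link K (x ∪ (z ∖ x)))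
  unique-∂⊕Link = unique-⊕ c∂ cLk ∂#Link

  Link-S⁻ : u ∈ Link (S K x) z → u ∈ ∂ (x ∖ z) ⊕ Link K (x ∪ (z ∖ x))
  Link-S⁻ {u} u∈Lk with ∈-Link⁻ (S K x) z u∈Lk
  ... | u∈S , u#z , z∪u∈S with ∈-S⁻ u∈S | ∈-S⁻ z∪u∈S
  ... | u∈K , _ | _ , (w , w∈K , x⊑w , z∪u⊑w) , x⋢z∪u =
    subst (_∈ _) (sym u≡) (∈-⊕⁺ u₁∈₀∂s u₂∈₀Lk (complex-nonempty cK u∈K ∘ ≡-trans u≡))
    where
    iu = complex-increasing cK u∈K
    u₁ = u ∩ x
    u₂ = u ∖ x
    u≡ = ∩∪∖ x iu
    u₂#t : Disjoint u₂ t
    u₂#t (v∈u₂ , v∈t) = let (v∈u , v∉x) = ∈-∖⁻ u x v∈u₂ in case ∈-∪⁻ x l v∈t of λ where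
      (inj₁ v∈x) → v∉x v∈x
      (inj₂ v∈l) → u#z (v∈u , All.lookup l⊑z v∈l)
    u₁∈₀∂s : u₁ ∈₀ ∂ s
    u₁∈₀∂s = ∈₀-intro λ u₁≢[] → ∈-∂⁺ is (increasing-∩ x iu)
      (All.tabulate λ v∈u₁ → let (v∈u , v∈x) = ∈-∩⁻ u x v∈u₁ in ∈-∖⁺ z v∈x (λ v∈z → u#z (v∈u , v∈z)))
      u₁≢[]
      λ u₁≡s → x⋢z∪u (All.tabulate λ v∈x → case ∈-∩∖ x z v∈x of λ where
        (inj₁ v∈x∩z) → ∈-∪⁺ˡ u (All.lookup (∩-⊑ʳ x z) v∈x∩z)
        (inj₂ v∈s) → ∈-∪⁺ʳ z (All.lookup (∩-⊑ˡ u x) (subst (_ ∈_) (sym u₁≡s) v∈s)))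
    u₂∈₀Lk : u₂ ∈₀ Link K t
    u₂∈₀Lk = ∈₀-intro λ u₂≢[] → ∈-Link⁺
      (complex-downClosed cK u∈K (increasing-∖ x iu) u₂≢[] (∖-⊑ u x))
      u₂#t
      (complex-downClosed cK w∈K (increasing-∪ it (increasing-∖ x iu) (disjoint-sym u₂#t))
        (∪-nonemptyˡ u₂ (∪-nonemptyˡ l x≢[]))
        (∪-⊑ (∪-⊑ x⊑w (⊑-trans (⊑-trans l⊑z (⊑-∪ˡ z u)) z∪u⊑w))
             (⊑-trans (⊑-trans (∖-⊑ u x) (⊑-∪ʳ z u)) z∪u⊑w)))
  Link-S⁺ : u ∈ ∂ (x ∖ z) ⊕ Link K (x ∪ (z ∖ x)) → u ∈ Link (S K x) z
  Link-S⁺ u∈ with ∈-⊕⁻ (∂ s) (Link K t) u∈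
  ... | u₁ , u₂ , u₁∈₀∂s , u₂∈₀Lk , refl = ∈-Link⁺ u∈S u#z z∪u∈S
    where
    u≢[] = ⊕-faces-nonempty (complex-nonempty c∂) (complex-nonempty cLk) u∈
    u₂#t = ∈₀-Link⇒disjoint K t u₂∈₀Lk
    u₁⊑s : u₁ ⊑ s
    u₁⊑s = [ (λ { refl → [] }) , proj₁ ∘ proj₂ ∘ ∈-∂⁻ is ] u₁∈₀∂s
    w = t ∪ u₂
    w∈K : w ∈ K
    w∈K = ∈₀-nonempty (∈₀-Link⇒∪∈₀ K t (inj₂ S-link-centre∈K) u₂∈₀Lk) (∪-nonemptyˡ u₂ (∪-nonemptyˡ l x≢[]))
    x⊑w = ⊑-trans (⊑-∪ˡ x l) (⊑-∪ˡ t u₂)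
    z⊑w = ⊑-trans z⊑t (⊑-∪ˡ t u₂)
    u⊑w : u₁ ∪ u₂ ⊑ w
    u⊑w = ∪-⊑ (⊑-trans u₁⊑s (⊑-trans s⊑t (⊑-∪ˡ t u₂))) (⊑-∪ʳ t u₂)
    iu = increasing-⊕ c∂ cLk ∂#Link u∈
    u#z : Disjoint (u₁ ∪ u₂) z
    u#z = disjoint-∪ˡ (λ (v∈u₁ , v∈z) → s#z (All.lookup u₁⊑s v∈u₁ , v∈z))
                      (λ (v∈u₂ , v∈z) → u₂#t (v∈u₂ , All.lookup z⊑t v∈z))
    x⋢ : ∀ {f} → (∀ {v} → v ∈ x → v ∈ f) → (∀ {v} → v ∈ f → v ∈ z ⊎ v ∈ u₁ ∪ u₂) → ⊥
    x⋢ x⊆f f⊆ = ∂₀-proper is S-link-vertices-nonempty u₁∈₀∂s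
      (s⊑-part u₂#t λ v∈s → f⊆ (x⊆f (All.lookup (∖-⊑ x z) v∈s)))
    u∈S : u₁ ∪ u₂ ∈ S K x
    u∈S = ∈-S⁺ (complex-downClosed cK w∈K iu u≢[] u⊑w) w∈K x⊑w u⊑w λ x⊑u → x⋢ (All.lookup x⊑u) inj₂
    z∪u∈S : z ∪ (u₁ ∪ u₂) ∈ S K x
    z∪u∈S = ∈-S⁺ (complex-downClosed cK w∈K (increasing-∪ iz iu (disjoint-sym u#z))
                    (∪-nonemptyʳ z u≢[]) (∪-⊑ z⊑w u⊑w))
                 w∈K x⊑w (∪-⊑ z⊑w u⊑w)
                 λ x⊑z∪u → x⋢ (All.lookup x⊑z∪u) (∈-∪⁻ z (u₁ ∪ u₂))

  Link-S : Link (S K x) z ∼[ set ] ∂ (x ∖ z) ⊕ Link K (x ∪ (z ∖ x))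
  Link-S = mk⇔ Link-S⁻ Link-S⁺

-- Here n = q + 1 for a q-dimensional complex: the link of a face with k vertices should be a (q - k)-sphere.
EulerLinkAt : ℕ → Complex → Face → Set
EulerLinkAt n K z = ∃ λ d → length z ℕ.+ d ≡ n × EulerSphere d (Link K z)

EulerLinks : ℕ → Complex → Set
EulerLinks n K = ∀ {x} → x ∈ K → EulerLinkAt n K x

EulerLinks₀ : ℕ → Complex → Set
EulerLinks₀ n K = ∀ {x} → x ∈₀ K → EulerLinkAt n K x

eulerSphere-Link-[] : ∀ {d} → IsComplex K → EulerSphere d (Link K []) → EulerSphere d K
eulerSphere-Link-[] cK = eulerSphere-resp-set (unique-Link [] (complex-unique cK)) (complex-unique cK) Link-[]

eulerLinks₀-intro : IsComplex K → EulerLinks n K → EulerSphere n K → EulerLinks₀ n K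
eulerLinks₀-intro cK links sphere (inj₁ refl) =
  _ , refl , eulerSphere-resp-set (complex-unique cK) (unique-Link [] (complex-unique cK)) (⇔-sym Link-[]) sphere
eulerLinks₀-intro cK links sphere (inj₂ x∈K) = links x∈K

eulerLinks₀-S : IsComplex K → EulerLinks (suc m) K → x ∈ K → EulerLinks₀ m (S K x)
eulerLinks₀-S {K} {m} {x} cK links x∈K {z} z∈₀S with links (S-link-centre∈K cK x∈K z∈₀S)
... | d , |t|+d≡1+m , sphere-t =
  ℕ.pred (length s) ℕ.+ d ,
  dimension ,
  eulerSphere-resp-set (unique-∂⊕Link cK x∈K z∈₀S) (unique-Link z (complex-unique (isComplex-S x cK)))
    (⇔-sym (Link-S cK x∈K z∈₀S))
    (eulerSphere-⊕ (eulerSphere-∂ s (increasing-∖ z (complex-increasing cK x∈K))) sphere-t)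
  where
  s = x ∖ z
  dimension : length z ℕ.+ (ℕ.pred (length s) ℕ.+ d) ≡ m
  dimension = ℕ.suc-injective (begin
    suc (length z ℕ.+ (ℕ.pred (length s) ℕ.+ d))   ≡⟨ sym (ℕ.+-suc (length z) _) ⟩
    length z ℕ.+ (suc (ℕ.pred (length s)) ℕ.+ d)   ≡⟨ cong (λ k → length z ℕ.+ (k ℕ.+ d)) (suc-pred-length (S-link-vertices-nonempty cK x∈K z∈₀S)) ⟩
    length z ℕ.+ (length s ℕ.+ d)                  ≡⟨ sym (ℕ.+-assoc (length z) (length s) d) ⟩
    length z ℕ.+ length s ℕ.+ d                    ≡⟨ cong (ℕ._+ d) (length-S-link cK x∈K z∈₀S) ⟩
    length (x ∪ (z ∖ x)) ℕ.+ d                     ≡⟨ |t|+d≡1+m ⟩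
    suc m                                          ∎)
    where open ≡-Reasoning

facet∈₀S : IsComplex K → v ∷ x ∈ K → x ∈₀ S K (v ∷ x)
facet∈₀S cK v∷x∈K with complex-increasing cK v∷x∈K
... | v<x ∷ ix = ∈₀-intro λ x≢[] → ∈-S⁺ (complex-downClosed cK v∷x∈K ix x≢[] ⊑-∷) v∷x∈K ⊑-refl ⊑-∷
                   λ v∷x⊑x → ℕ.<-irrefl refl (All.lookup v<x (All.head v∷x⊑x))

-- The link of v ∷ t in K is the link of its facet t inside S(v ∷ t), the join factor ∂ {v} being empty.
eulerLinkAt-from-S : IsComplex K → x ∈ K → EulerLinks₀ m (S K x) → EulerLinkAt (suc m) K x
eulerLinkAt-from-S {x = []} cK []∈K _ = ⊥-elim (complex-nonempty cK []∈K refl)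
eulerLinkAt-from-S {K} {v ∷ t} cK x∈K links with links (facet∈₀S cK x∈K)
... | d , |t|+d≡m , sphere-in-S = d , cong suc |t|+d≡m , subst (EulerSphere d) Link≡ sphere-⊕
  where
  t∈₀S = facet∈₀S cK x∈K
  s = (v ∷ t) ∖ t
  sphere-⊕ = eulerSphere-resp-set (unique-Link t (complex-unique (isComplex-S _ cK))) (unique-∂⊕Link cK x∈K t∈₀S)
               (Link-S cK x∈K t∈₀S) sphere-in-S
  t∖x≡[] : t ∖ (v ∷ t) ≡ []
  t∖x≡[] = ⊑⇒∖≡[] {t} {v ∷ t} ⊑-∷
  |s|≡1 : length s ≡ 1
  |s|≡1 = ℕ.+-cancelˡ-≡ (length t) (length s) 1 (≡-trans (length-S-link cK x∈K t∈₀S) (begin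
    length ((v ∷ t) ∪ (t ∖ (v ∷ t)))   ≡⟨ cong (λ l → length ((v ∷ t) ∪ l)) t∖x≡[] ⟩
    length ((v ∷ t) ∪ [])              ≡⟨ ℕ.+-comm 1 (length t) ⟩
    length t ℕ.+ 1                     ∎))
    where open ≡-Reasoning
  ∂s≡[] : ∂ s ≡ []
  ∂s≡[] = empty (eulerSphere-∂ s (increasing-∖ t (complex-increasing cK x∈K))) (cong ℕ.pred |s|≡1)
  Link≡ : ∂ s ⊕ Link K ((v ∷ t) ∪ (t ∖ (v ∷ t))) ≡ Link K (v ∷ t)
  Link≡ = ≡-trans (cong₂ (λ A l → A ⊕ Link K ((v ∷ t) ∪ l)) ∂s≡[] t∖x≡[]) (List.++-identityʳ (Link K (v ∷ t)))

χ̃-sphere⇒χ : χ̃ K ≡ -1^ suc (suc m) → χ K ≡ + 1 + -1ℤ ^ m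
χ̃-sphere⇒χ {K} {m} χ̃≡ = ≡-trans (shift (χ K)) (cong (_+_ (+ 1)) (≡-trans χ̃≡ (-1^-2+ m)))
  where
  shift : ∀ i → i ≡ + 1 + (i - + 1)
  shift = solve-∀

χ⇒χ̃-sphere : χ K ≡ + 1 + -1ℤ ^ m → χ̃ K ≡ -1^ suc (suc m)
χ⇒χ̃-sphere {K} {m} χ≡ = ≡-trans (cong (_- + 1) χ≡) (≡-trans (unshift (-1^ m)) (sym (-1^-2+ m)))
  where
  unshift : ∀ i → + 1 + i - + 1 ≡ i
  unshift = solve-∀

mutual
  eulerLinks₀⇒dsSphere : ∀ n → IsComplex K → EulerLinks₀ n K → DSSphere₊₁ n K
  eulerLinks₀⇒dsSphere zero cK links with links (inj₁ refl)
  ... | _ , refl , sphere = empty (eulerSphere-Link-[] cK sphere) refl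
  eulerLinks₀⇒dsSphere {K} (suc m) cK links with links (inj₁ refl)
  ... | _ , refl , sphere-Link =
    eulerLinks⇒dsManifold m cK (nonempty sphere (s≤s z≤n)) (links ∘ inj₂) , χ̃-sphere⇒χ {K} {m} (χ̃-sphere sphere)
    where sphere = eulerSphere-Link-[] cK sphere-Link

  eulerLinks⇒dsManifold : ∀ m → IsComplex K → K ≢ [] → EulerLinks (suc m) K → DSManifold₊₁ (suc m) K
  eulerLinks⇒dsManifold m cK K≢[] links =
    K≢[] , λ x∈K → eulerLinks₀⇒dsSphere m (isComplex-S _ cK) (eulerLinks₀-S cK links x∈K)

mutual
  dsSphere⇒eulerLinks₀ : ∀ n → IsComplex K → DSSphere₊₁ n K → EulerLinks₀ n K
  dsSphere⇒eulerLinks₀ zero cK refl (inj₁ refl) = 0 , refl , eulerSphere (λ ()) (λ _ → refl) refl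
  dsSphere⇒eulerLinks₀ {K} (suc m) cK (manifold , χ≡) = eulerLinks₀-intro cK (dsManifold⇒eulerLinks m cK manifold)
    (eulerSphere (λ _ → proj₁ manifold) (λ ()) (χ⇒χ̃-sphere {K} {m} χ≡))

  dsManifold⇒eulerLinks : ∀ m → IsComplex K → DSManifold₊₁ (suc m) K → EulerLinks (suc m) K
  dsManifold⇒eulerLinks m cK (_ , spheres) x∈K =
    eulerLinkAt-from-S cK x∈K (dsSphere⇒eulerLinks₀ m (isComplex-S _ cK) (spheres x∈K))

∈₀-⊕⁻ : ∀ A B → z ∈₀ A ⊕ B → ∃ λ a → ∃ λ b → a ∈₀ A × b ∈₀ B × z ≡ a ∪ b
∈₀-⊕⁻ A B (inj₁ refl) = [] , [] , inj₁ refl , inj₁ refl , refl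
∈₀-⊕⁻ A B (inj₂ z∈) = ∈-⊕⁻ A B z∈

eulerLinks₀-⊕ : ∀ {A B} → IsComplex A → IsComplex B → DisjointVertices A B →
                EulerLinks₀ m A → EulerLinks₀ n B → EulerLinks₀ (m ℕ.+ n) (A ⊕ B)
eulerLinks₀-⊕ {m} {n} {A} {B} cA cB A#B linksA linksB z∈₀ with ∈₀-⊕⁻ A B z∈₀
... | a , b , a∈₀A , b∈₀B , refl with linksA a∈₀A | linksB b∈₀B
...   | dA , |a|+dA≡m , sphereA | dB , |b|+dB≡n , sphereB =
  dA ℕ.+ dB ,
  ≡-trans (cong (ℕ._+ (dA ℕ.+ dB)) (length-∪ a b))
          (≡-trans (+-interchange (length a) (length b) dA dB) (cong₂ ℕ._+_ |a|+dA≡m |b|+dB≡n)) ,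
  eulerSphere-resp-set unique-links (unique-Link (a ∪ b) (unique-⊕ cA cB A#B)) (⇔-sym (Link-⊕ cA cB A#B a∈₀A b∈₀B))
    (eulerSphere-⊕ sphereA sphereB)
  where
  unique-links : Unique (Link A a ⊕ Link B b)
  unique-links = unique-⊕ (isComplex-Link a (complex-increasing₀ cA a∈₀A) cA) (isComplex-Link b (complex-increasing₀ cB b∈₀B) cB)
    λ f∈ g∈ → A#B (proj₁ (∈-Link⁻ A a f∈)) (proj₁ (∈-Link⁻ B b g∈))

-1^-even-sum : ∀ k m n → m ℕ.+ n ≡ k ℕ.+ k → -1^ n ≡ -1^ m
-1^-even-sum k m n m+n≡k+k = begin
  -1^ n                       ≡⟨ sym (ℤ.*-identityˡ (-1^ n)) ⟩
  + 1 * -1^ n                 ≡⟨ cong (_* -1^ n) (sym (-1^-square m)) ⟩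
  -1^ m * -1^ m * -1^ n       ≡⟨ ℤ.*-assoc (-1^ m) (-1^ m) (-1^ n) ⟩
  -1^ m * (-1^ m * -1^ n)     ≡⟨ cong (-1^ m *_) (sym (-1^-+ m n)) ⟩
  -1^ m * -1^ (m ℕ.+ n)       ≡⟨ cong (λ j → -1^ m * -1^ j) m+n≡k+k ⟩
  -1^ m * -1^ (k ℕ.+ k)       ≡⟨ cong (-1^ m *_) (≡-trans (-1^-+ k k) (-1^-square k)) ⟩
  -1^ m * + 1                 ≡⟨ ℤ.*-identityʳ (-1^ m) ⟩
  -1^ m                       ∎
  where open ≡-Reasoning

module _ (cK : IsComplex K) where

  χ-closedSimplex : y ∈ K → χ (filter (_⊑? y) K) ≡ + 1
  χ-closedSimplex {[]} []∈K = ⊥-elim (complex-nonempty cK []∈K refl)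
  χ-closedSimplex {y@(v ∷ t)} y∈K = begin
    χ (filter (_⊑? y) K)        ≡⟨ χ-resp-set (Unique.filter⁺ (_⊑? y) (complex-unique cK)) unique-y∷∂y (mk⇔ to from) ⟩
    ω y + χ (∂ y)               ≡⟨ cong (_+_ (ω y)) (shift (χ (∂ y))) ⟩
    ω y + (χ̃ (∂ y) + + 1)       ≡⟨ cong (λ i → ω y + (i + + 1)) (χ̃-sphere (eulerSphere-∂ y iy)) ⟩
    - -1^ length y + (-1^ length y + + 1)   ≡⟨ cancel (-1^ length y) ⟩
    + 1                         ∎
    where
    open ≡-Reasoning
    iy = complex-increasing cK y∈K
    shift : ∀ i → i ≡ i - + 1 + + 1
    shift = solve-∀
    cancel : ∀ i → - i + (i + + 1) ≡ + 1
    cancel = solve-∀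
    unique-y∷∂y : Unique (y ∷ ∂ y)
    unique-y∷∂y = All.tabulate (λ x∈∂y y≡x → proj₂ (proj₂ (proj₂ (∈-∂⁻ iy x∈∂y))) (sym y≡x)) ∷ unique-∂ iy
    to : x ∈ filter (_⊑? y) K → x ∈ y ∷ ∂ y
    to {x} x∈ with ∈-filter⁻ (_⊑? y) x∈ | x ≟ y
    ... | _ | yes x≡y = here x≡y
    ... | x∈K , x⊑y | no x≢y = there (∈-∂⁺ iy (complex-increasing cK x∈K) x⊑y (complex-nonempty cK x∈K) x≢y)
    from : x ∈ y ∷ ∂ y → x ∈ filter (_⊑? y) K
    from (here refl) = ∈-filter⁺ (_⊑? y) y∈K ⊑-refl
    from (there x∈∂y) with ∈-∂⁻ iy x∈∂y
    ... | ix , x⊑y , x≢[] , _ = ∈-filter⁺ (_⊑? y) (complex-downClosed cK y∈K ix x≢[] x⊑y) x⊑y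

  unique-star : x ∈ K → Unique (x ∷ map (x ∪_) (Link K x))
  unique-star {x} x∈K = All-map⁺ (All.tabulate x≢x∪u) ∷
    unique-map⁺ (λ u∈ u′∈ → ∪-cancelʳ (iu u∈) (iu u′∈) (disjoint-sym (u#x u′∈)) (disjoint-sym (u#x u∈)))
                (unique-Link x (complex-unique cK))
    where
    iu : u ∈ Link K x → Increasing u
    iu = complex-increasing cK ∘ proj₁ ∘ ∈-Link⁻ K x
    u#x : u ∈ Link K x → Disjoint u x
    u#x = proj₁ ∘ proj₂ ∘ ∈-Link⁻ K x
    x≢x∪u : u ∈ Link K x → x ≢ x ∪ u
    x≢x∪u {u} u∈Lk x≡x∪u with ≢[]⇒∈ (complex-nonempty cK (proj₁ (∈-Link⁻ K x u∈Lk)))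
    ... | v , v∈u = u#x u∈Lk (v∈u , subst (_ ∈_) (sym x≡x∪u) (∈-∪⁺ʳ x v∈u))

  star-∼ : x ∈ K → U K x ∼[ set ] (x ∷ map (x ∪_) (Link K x))
  star-∼ {x} x∈K = mk⇔ to from
    where
    to : y ∈ U K x → y ∈ x ∷ map (x ∪_) (Link K x)
    to {y} y∈U with ∈-filter⁻ (x ⊑?_) y∈U | y ≟ x
    ... | _ | yes y≡x = here y≡x
    ... | y∈K , x⊑y | no y≢x = there (subst (_∈ _) (sym y≡x∪l) (∈-map⁺ (x ∪_) l∈Lk))
      where
      iy = complex-increasing cK y∈K
      y≡x∪l = ∪-∖ (complex-increasing cK x∈K) iy x⊑y
      l∈Lk : y ∖ x ∈ Link K x
      l∈Lk = ∈-Link⁺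
        (complex-downClosed cK y∈K (increasing-∖ x iy)
          (λ l≡[] → y≢x (≡-trans (≡-trans y≡x∪l (cong (x ∪_) l≡[])) (∪-identityʳ x))) (∖-⊑ y x))
        (∖-disjoint y x) (subst (_∈ K) y≡x∪l y∈K)
    from : y ∈ x ∷ map (x ∪_) (Link K x) → y ∈ U K x
    from (here refl) = ∈-filter⁺ (x ⊑?_) x∈K ⊑-refl
    from (there y∈) with ∈-map⁻ (x ∪_) y∈
    ... | u , u∈Lk , refl = ∈-filter⁺ (x ⊑?_) (proj₂ (proj₂ (∈-Link⁻ K x u∈Lk))) (⊑-∪ˡ x u)

  χ-star : x ∈ K → χ (U K x) ≡ - (ω x * χ̃ (Link K x))
  χ-star {x} x∈K = begin
    χ (U K x)                           ≡⟨ χ-resp-set (Unique.filter⁺ (x ⊑?_) (complex-unique cK)) (unique-star x∈K) (star-∼ x∈K) ⟩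
    ω x + χ (map (x ∪_) (Link K x))     ≡⟨ cong (_+_ (ω x)) (χ-map-∪ x (Link K x)) ⟩
    ω x + - (ω x * χ (Link K x))        ≡⟨ factor (ω x) (χ (Link K x)) ⟩
    - (ω x * χ̃ (Link K x))              ∎
    where
    open ≡-Reasoning
    factor : ∀ i j → i + - (i * j) ≡ - (i * (j - + 1))
    factor = solve-∀

  -- Double counting of pairs x ⊆ y weighted by ω(x)ω(y) (the Dehn–Sommerville relation):
  -- summing over x first gives -χ K, summing over y first gives χ K.
  eulerLinks-even⇒χ≡0 : ∀ k → EulerLinks (k ℕ.+ k) K → χ K ≡ + 0
  eulerLinks-even⇒χ≡0 k links = i≡-i⇒i≡0 (begin
    χ K                                                   ≡⟨ ∑-cong K (λ {y} y∈K → sym (≡-trans (cong (ω y *_) (χ-closedSimplex y∈K)) (ℤ.*-identityʳ (ω y)))) ⟩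
    ∑ (λ y → ω y * χ (filter (_⊑? y) K)) K                ≡⟨ ∑-cong K (λ {y} _ → ≡-trans (cong (ω y *_) (∑-filter (_⊑? y) ω K)) (∑-*ˡ (ω y) (λ x → [ x ⊑ y ] ω x) K)) ⟩
    ∑ (λ y → ∑ (λ x → ω y * [ x ⊑ y ] ω x) K) K           ≡⟨ ∑-comm (λ y x → ω y * [ x ⊑ y ] ω x) K K ⟩
    ∑ (λ x → ∑ (λ y → ω y * [ x ⊑ y ] ω x) K) K           ≡⟨ ∑-cong K (λ {x} _ → ∑-cong K (λ {y} _ → swap-weights (does (x ⊑? y)) (ω y) (ω x))) ⟩
    ∑ (λ x → ∑ (λ y → ω x * [ x ⊑ y ] ω y) K) K           ≡⟨ ∑-cong K (λ {x} _ → sym (≡-trans (cong (ω x *_) (∑-filter (x ⊑?_) ω K)) (∑-*ˡ (ω x) (λ y → [ x ⊑ y ] ω y) K))) ⟩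
    ∑ (λ x → ω x * χ (U K x)) K                           ≡⟨ ∑-cong K ω*χ-star ⟩
    ∑ (λ x → - ω x) K                                     ≡⟨ ∑-neg ω K ⟩
    - χ K                                                 ∎)
    where
    open ≡-Reasoning
    [_⊑_]_ : Face → Face → ℤ → ℤ
    [ x ⊑ y ] i = if does (x ⊑? y) then i else + 0
    swap-weights : ∀ b i j → i * (if b then j else + 0) ≡ j * (if b then i else + 0)
    swap-weights true i j = ℤ.*-comm i j
    swap-weights false i j = ≡-trans (ℤ.*-zeroʳ i) (sym (ℤ.*-zeroʳ j))
    i≡-i⇒i≡0 : ∀ {i} → i ≡ - i → i ≡ + 0
    i≡-i⇒i≡0 {+ zero} _ = refl
    i≡-i⇒i≡0 {+ suc _} ()
    i≡-i⇒i≡0 { -[1+ _ ]} ()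
    ω*χ-star : x ∈ K → ω x * χ (U K x) ≡ - ω x
    ω*χ-star {x} x∈K with links x∈K
    ... | d , |x|+d≡k+k , sphere = begin
      ω x * χ (U K x)                     ≡⟨ cong (ω x *_) (χ-star x∈K) ⟩
      ω x * - (ω x * χ̃ (Link K x))        ≡⟨ rearrange (ω x) (χ̃ (Link K x)) ⟩
      - ((ω x * ω x) * χ̃ (Link K x))      ≡⟨ cong (λ i → - (i * χ̃ (Link K x))) (ω-square x) ⟩
      - (+ 1 * χ̃ (Link K x))              ≡⟨ cong -_ (ℤ.*-identityˡ _) ⟩
      - χ̃ (Link K x)                      ≡⟨ cong -_ (≡-trans (χ̃-sphere sphere) (-1^-suc d)) ⟩
      - - -1^ d                           ≡⟨ cong (-_ ∘ -_) (-1^-even-sum k (length x) d |x|+d≡k+k) ⟩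
      - ω x                               ∎
      where
      rearrange : ∀ i j → i * - (i * j) ≡ - ((i * i) * j)
      rearrange = solve-∀

dsSphere⇒dsManifold : ∀ n → DSSphere₊₁ n K → DSManifold₊₁ n K
dsSphere⇒dsManifold zero K≡[] = K≡[]
dsSphere⇒dsManifold (suc m) (manifold , _) = manifold

-- By the Dehn–Sommerville relation an odd-dimensional manifold has χ = 0, so it satisfies the link condition at ∅ as well.
evenDSManifold⇒eulerLinks₀ : ∀ k → IsComplex K → DSManifold₊₁ (k ℕ.+ k) K → EulerLinks₀ (k ℕ.+ k) K
evenDSManifold⇒eulerLinks₀ zero cK refl (inj₁ refl) = 0 , refl , eulerSphere (λ ()) (λ _ → refl) refl
evenDSManifold⇒eulerLinks₀ {K} (suc j) cK manifold =
  eulerLinks₀-intro cK links (eulerSphere (λ _ → proj₁ manifold) (λ ()) χ̃≡)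
  where
  links = dsManifold⇒eulerLinks (j ℕ.+ suc j) cK manifold
  χ̃≡ : χ̃ K ≡ -1^ suc (suc j ℕ.+ suc j)
  χ̃≡ = begin
    χ K - + 1                       ≡⟨ cong (_- + 1) (eulerLinks-even⇒χ≡0 cK (suc j) links) ⟩
    - + 1                           ≡⟨ cong -_ (sym (≡-trans (-1^-+ (suc j) (suc j)) (-1^-square (suc j)))) ⟩
    - -1^ (suc j ℕ.+ suc j)         ≡⟨ sym (-1^-suc (suc j ℕ.+ suc j)) ⟩
    -1^ suc (suc j ℕ.+ suc j)       ∎
    where open ≡-Reasoning

dsManifold-⊕ : ∀ j k {A B} → IsComplex A → IsComplex B → DisjointVertices A B →
               DSManifold₊₁ (j ℕ.+ j) A → DSManifold₊₁ (k ℕ.+ k) B → DSManifold₊₁ (j ℕ.+ j ℕ.+ (k ℕ.+ k)) (A ⊕ B)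
dsManifold-⊕ j k cA cB A#B manifoldA manifoldB = dsSphere⇒dsManifold _ (eulerLinks₀⇒dsSphere _ (isComplex-⊕ cA cB A#B)
  (eulerLinks₀-⊕ cA cB A#B (evenDSManifold⇒eulerLinks₀ j cA manifoldA) (evenDSManifold⇒eulerLinks₀ k cB manifoldB)))

odd-dimension⇒even : ∀ {a} → Odd a → a ≡ + n - + 1 → ∃ λ j → n ≡ j ℕ.+ j
odd-dimension⇒even {n} {a} (k , a≡2k+1) a≡n-1 = ∣ k + + 1 ∣ , (begin
  n                             ≡⟨ cong ∣_∣ +n≡2[k+1] ⟩
  ∣ + 2 * (k + + 1) ∣           ≡⟨ ℤ.abs-* (+ 2) (k + + 1) ⟩
  2 ℕ.* ∣ k + + 1 ∣             ≡⟨ cong (∣ k + + 1 ∣ ℕ.+_) (ℕ.+-identityʳ ∣ k + + 1 ∣) ⟩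
  ∣ k + + 1 ∣ ℕ.+ ∣ k + + 1 ∣   ∎)
  where
  open ≡-Reasoning
  +n≡2[k+1] : + n ≡ + 2 * (k + + 1)
  +n≡2[k+1] = begin
    + n                  ≡⟨ add-sub (+ n) ⟩
    + n - + 1 + + 1      ≡⟨ cong (_+ + 1) (≡-trans (sym a≡n-1) a≡2k+1) ⟩
    + 2 * k + + 1 + + 1  ≡⟨ double k ⟩
    + 2 * (k + + 1)      ∎
    where
    add-sub : ∀ i → i ≡ i - + 1 + + 1
    add-sub = solve-∀
    double : ∀ i → + 2 * i + + 1 + + 1 ≡ + 2 * (i + + 1)
    double = solve-∀

mainTheorem4 : (A B : Complex) (a b : ℤ) →
    IsComplex A → IsComplex B → DisjointVertices A B →
    Odd a → Odd b →
    IsDSManifold a A → IsDSManifold b B →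
    IsComplex (A ⊕ B) × IsDSManifold (a + b + + 1) (A ⊕ B)
mainTheorem4 A B a b cA cB A#B odd-a odd-b (nA , a≡ , manifoldA) (nB , b≡ , manifoldB)
  with odd-dimension⇒even {nA} odd-a a≡ | odd-dimension⇒even {nB} odd-b b≡
... | j , refl | k , refl =
  isComplex-⊕ cA cB A#B ,
  j ℕ.+ j ℕ.+ (k ℕ.+ k) , dimension , dsManifold-⊕ j k cA cB A#B manifoldA manifoldB
  where
  dimension : a + b + + 1 ≡ + (j ℕ.+ j ℕ.+ (k ℕ.+ k)) - + 1
  dimension = ≡-trans (cong₂ (λ i i′ → i + i′ + + 1) a≡ b≡)
                      (≡-trans (regroup (+ (j ℕ.+ j)) (+ (k ℕ.+ k))) (cong (_- + 1) (sym (ℤ.pos-+ (j ℕ.+ j) (k ℕ.+ k)))))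
    where
    regroup : ∀ m n → m - + 1 + (n - + 1) + + 1 ≡ m + n - + 1
    regroup = solve-∀
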